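{- Let $k\ge3$ and $2\le i\le k-1$. Let $\sigma=\sigma_1\sigma_2\cdots\sigma_k\text{ - }\sigma_{k+1}$ be the vincular pattern of length $k+1$ with $\sigma_1<\sigma_2<\cdots<\sigma_{i-1}<\sigma_i>\sigma_{i+1}>\cdots>\sigma_k$ and $\sigma_{k+1}=k+1$. Let $\tau=\tau_1\cdots\tau_k\text{ - }\tau_{k+1}$ be the pattern obtained from $\sigma$ by interchanging the letters $k$ and $k+1$. Then $\sigma$ and $\tau$ are Wilf-equivalent, and this equivalence respects the first letter statistic: for all $n\ge1$ and $a\in[n]$, the number of $\pi\in\mathcal{S}_n(\sigma)$ with $\pi_1=a$ equals the number of $\pi\in\mathcal{S}_n(\tau)$ with $\pi_1=a$.
   Context: A vincular pattern is a permutation $\rho\in\mathcal{S}_m$ written with dashes between some consecutive entries; $\pi\in\mathcal{S}_n$ contains it if there are indices $i_1<\cdots<i_m$ with $\pi_{i_1}\cdots\pi_{i_m}$ order-isomorphic to $\rho$ (same relative order) and $i_{j+1}=i_j+1$ whenever $\rho_j,\rho_{j+1}$ are not separated by a dash; otherwise $\pi$ avoids it. $\mathcal{S}_n(\rho)$ is the set of $\rho$-avoiding permutations in $\mathcal{S}_n$. Patterns $\rho,\rho'$ are Wilf-equivalent if $|\mathcal{S}_n(\rho)|=|\mathcal{S}_n(\rho')|$ for all $n\ge0$. -}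

module Defs where

open import Data.Nat using (ℕ; zero; suc; _+_; _≡ᵇ_; _<ᵇ_)
open import Data.Bool using (Bool; true; false; _∧_; _∨_; not; if_then_else_; T)
open import Data.List using (List; []; _∷_; length; map; upTo)
open import Data.Bool.ListAction using (any; all)
open import Data.Product using (Σ)

-- 1-based lookup: at xs j = x_j (and 0 if j is out of range).
at : List ℕ → ℕ → ℕ
at []       _             = 0
at (x ∷ xs) zero          = 0
at (x ∷ xs) (suc zero)    = x
at (x ∷ xs) (suc (suc j)) = at xs (suc j)

oneTo : ℕ → List ℕ
oneTo n = map suc (upTo n)

elem : ℕ → List ℕ → Bool
elem x = any (λ y → x ≡ᵇ y)

isPerm : ℕ → List ℕ → Bool
isPerm n π = (length π ≡ᵇ n) ∧ all (λ j → elem j π) (oneTo n)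

-- order-isomorphism of two sequences: same length and for all j < l,
-- x_j < x_l iff y_j < y_l  (sequences of distinct values)
sameOrder : List ℕ → List ℕ → Bool
sameOrder [] [] = true
sameOrder (x ∷ xs) (y ∷ ys) = cmp xs ys ∧ sameOrder xs ys
  where
  cmp : List ℕ → List ℕ → Bool
  cmp [] [] = true
  cmp (x' ∷ xs') (y' ∷ ys') = ((x <ᵇ x') ≡ᵇ' (y <ᵇ y')) ∧ cmp xs' ys'
    where
    _≡ᵇ'_ : Bool → Bool → Bool
    true  ≡ᵇ' b = b
    false ≡ᵇ' b = not b
  cmp _ _ = false
sameOrder _ _ = false

-- A vincular pattern of length m: its letters ρ₁⋯ρₘ together with a list
-- adj of length m-1, where the j-th entry is true iff ρ_j and ρ_{j+1} are
-- NOT separated by a dash (so they must occur at adjacent positions).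
record Vincular : Set where
  constructor vinc
  field
    letters : List ℕ
    adj     : List Bool
open Vincular public

-- Subsequences π_{i₁}⋯π_{iₘ} (i₁ < ⋯ < iₘ) of a list whose first entry is
-- the head of the given list, respecting the adjacency constraints adj.
mutual
  occFrom : List Bool → List ℕ → List (List ℕ)
  occFrom _             []       = []
  occFrom []            (x ∷ _)  = (x ∷ []) ∷ []
  occFrom (true ∷ as)   (x ∷ xs) = map (x ∷_) (occFrom as xs)
  occFrom (false ∷ as)  (x ∷ xs) = map (x ∷_) (occAny as xs)

  occAny : List Bool → List ℕ → List (List ℕ)
  occAny as []       = []
  occAny as (x ∷ xs) = occFrom as (x ∷ xs) Data.List.++ occAny as xs

contains : Vincular → List ℕ → Bool
contains ρ π = any (λ s → sameOrder s (letters ρ)) (occAny (adj ρ) π)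

-- 𝒮ₙ(ρ) as a subset type (a Bool-valued predicate, so membership proofs are unique)
Av : Vincular → ℕ → Set
Av ρ n = Σ (List ℕ) λ π → T (isPerm n π ∧ not (contains ρ π))

AvFirst : Vincular → ℕ → ℕ → Set
AvFirst ρ n a = Σ (List ℕ) λ π → T (isPerm n π ∧ not (contains ρ π) ∧ (at π 1 ≡ᵇ a))

-- the vincular pattern σ₁⋯σ_k-σ_{k+1}: all consecutive entries among the
-- first k are adjacent, one dash between σ_k and σ_{k+1}
dashLast : ℕ → List ℕ → Vincular
dashLast k σ = vinc σ (adjs k)
  where
  adjs : ℕ → List Bool
  adjs zero          = []
  adjs (suc zero)    = false ∷ []
  adjs (suc (suc m)) = true ∷ adjs (suc m)

swapLetters : ℕ → List ℕ → List ℕ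
swapLetters k = map (λ x → if x ≡ᵇ k then suc k else (if x ≡ᵇ suc k then k else x))

-- Call a window of a list a factor order-isomorphic to u = σ₁⋯σ_k. As u rises for i - 1 ≥ 1 steps
-- to its maximum and then falls for k - i ≥ 1 steps, two windows never start fewer than k - 1
-- positions apart. At a window with peak c, call a later entry big if it exceeds all the other
-- entries of the window: an occurrence of σ starting there is a big entry above c, one of τ a big
-- entry below c. So at each window of a σ-avoider c is the largest of the peak values (c and the big
-- entries), and at each window of a τ-avoider the smallest. Working from right to left, the
-- bijection shifts the peak values of every window cyclically one step up, the largest becoming the
-- smallest, and its inverse shifts them down. Such a shift keeps the other entries of the window and
-- the relative order of all entries after the peak, so it keeps all other windows and occurrences,
-- and it never moves the first letter.

module Submission where

open import Defs
open import Data.Bool using (Bool; true; false; _∧_; _∨_; not; T; if_then_else_)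
open import Data.Bool.ListAction using (any; or)
open import Data.Bool.Properties using (T-∧; T-∨; T-≡; T-not-≡; T-irrelevant; ∨-assoc)
open import Data.Empty using (⊥; ⊥-elim)
open import Data.List using (List; []; _∷_; _++_; map; length; take; drop; filter; replicate; upTo)
open import Data.List.Extrema.Nat using (min; max; argmin-all; argmax-all; min≤xs; xs≤max; argmax-sel; argmin-sel)
open import Data.List.Membership.Propositional using (_∈_; _∉_; find)
open import Data.List.Membership.Propositional.Properties
  using (∈-++⁺ˡ; ∈-++⁺ʳ; ∈-++⁻; ∈-filter⁺; ∈-filter⁻; ∈-map⁺; ∈-map⁻; ∈-upTo⁺; ∈-upTo⁻; ∈-∃++)
open import Data.List.Properties
  using (∷-injectiveˡ; ∷-injectiveʳ; length-++; length-map; length-upTo; length-take; length-drop; map-++; map-∘;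
         map-cong; map-id; map-id-local; take-map; drop-drop; drop-all; take++drop≡id)
open import Data.List.Relation.Binary.Pointwise as Pointwise using (Pointwise; []; _∷_)
open import Data.List.Relation.Binary.Subset.Propositional using (_⊆_)
open import Data.List.Relation.Unary.All as All using (All; []; _∷_)
open import Data.List.Relation.Unary.All.Properties using (++⁺; ++⁻ˡ; ++⁻ʳ)
import Data.List.Relation.Unary.All.Properties as Allₚ
open import Data.List.Relation.Unary.AllPairs using ([]; _∷_)
open import Data.List.Relation.Unary.Any as Any using (Any; here; there)
open import Data.List.Relation.Unary.Any.Properties using (any⇔)
import Data.List.Relation.Unary.Any.Properties as Anyₚ
open import Data.List.Relation.Unary.Unique.Propositional using (Unique)
import Data.List.Relation.Unary.Unique.Propositional.Properties as Uniqueₚ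
open import Data.Nat using (ℕ; zero; suc; pred; >-nonZero; _+_; _∸_; _<_; _≤_; z≤n; s≤s; _<?_; _≤?_; _≟_; _<ᵇ_; _≡ᵇ_)
open import Data.Nat.Properties
open import Data.List.Membership.DecPropositional _≟_ using (_∈?_)
open import Data.Product using (Σ; ∃; _×_; _,_; proj₁; proj₂)
open import Data.Sum using (_⊎_; inj₁; inj₂; [_,_]′)
open import Function using (_⇔_; mk⇔; Equivalence; _∘_; id; _↔_; mk↔ₛ′)
open import Relation.Binary using (tri<; tri≈; tri>)
open import Relation.Binary.PropositionalEquality hiding ([_])
open import Relation.Nullary using (¬_; Dec; yes; no; contradiction)
open import Relation.Unary using (Decidable)

_⇔ᵇ_ : Bool → Bool → Bool
true  ⇔ᵇ b = b
false ⇔ᵇ b = not b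

T-⇔ᵇ : ∀ a b → T (a ⇔ᵇ b) ⇔ (a ≡ b)
T-⇔ᵇ true  true  = mk⇔ (λ _ → refl) _
T-⇔ᵇ true  false = mk⇔ (λ ()) (λ ())
T-⇔ᵇ false true  = mk⇔ (λ ()) (λ ())
T-⇔ᵇ false false = mk⇔ (λ _ → refl) _

T-injective : ∀ {a b} → (T a → T b) → (T b → T a) → a ≡ b
T-injective {false} {false} _ _ = refl
T-injective {false} {true}  _ g = ⊥-elim (g _)
T-injective {true}  {false} f _ = ⊥-elim (f _)
T-injective {true}  {true}  _ _ = refl

T-not : ∀ {b} → T (not b) ⇔ (¬ T b)
T-not {false} = mk⇔ (λ _ ()) _
T-not {true}  = mk⇔ (λ ()) (λ ¬t → ¬t _)

<ᵇ-true : ∀ {m n} → m < n → (m <ᵇ n) ≡ true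
<ᵇ-true = Equivalence.to T-≡ ∘ <⇒<ᵇ

<ᵇ-false : ∀ {m n} → n ≤ m → (m <ᵇ n) ≡ false
<ᵇ-false z≤n     = refl
<ᵇ-false (s≤s p) = <ᵇ-false p

<ᵇ-true⁻ : ∀ {m n} → (m <ᵇ n) ≡ true → m < n
<ᵇ-true⁻ {m} {n} = <ᵇ⇒< m n ∘ Equivalence.from T-≡

<ᵇ-false⁻ : ∀ {m n} → (m <ᵇ n) ≡ false → n ≤ m
<ᵇ-false⁻ {m}     {zero}  _ = z≤n
<ᵇ-false⁻ {suc m} {suc n} e = s≤s (<ᵇ-false⁻ e)

-- Order isomorphism

sameSides : ℕ → ℕ → List ℕ → List ℕ → Bool
sameSides x y []       []       = true
sameSides x y (a ∷ as) (b ∷ bs) = ((x <ᵇ a) ⇔ᵇ (y <ᵇ b)) ∧ sameSides x y as bs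
sameSides x y _        _        = false

-- The comparison function local to sameOrder has no accessible name.  This
-- definition names it: its body is solved by unification in sameOrder-∷,
-- where abstracting the parameters separates them from the arguments.
mutual
  cmp : ℕ → List ℕ → ℕ → List ℕ → List ℕ → List ℕ → Bool
  cmp = _

  sameOrder-∷ : ∀ x y xs ys → sameOrder (x ∷ xs) (y ∷ ys) ≡ sameSides x y xs ys ∧ sameOrder xs ys
  sameOrder-∷ x y []       []       = refl
  sameOrder-∷ x y []       (b ∷ bs) = refl
  sameOrder-∷ x y (a ∷ as) []       = refl
  sameOrder-∷ x y (a ∷ as) (b ∷ bs) with x <ᵇ a | a ∷ as | b ∷ bs
  ... | true  | P | Q = cong (λ r → ((y <ᵇ b) ∧ r) ∧ _) (cmp≡sameSides x y P Q as bs)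
  ... | false | P | Q = cong (λ r → (not (y <ᵇ b) ∧ r) ∧ _) (cmp≡sameSides x y P Q as bs)

  cmp≡sameSides : ∀ x y P Q xs ys → cmp x P y Q xs ys ≡ sameSides x y xs ys
  cmp≡sameSides x y P Q []       []       = refl
  cmp≡sameSides x y P Q []       (b ∷ bs) = refl
  cmp≡sameSides x y P Q (a ∷ as) []       = refl
  cmp≡sameSides x y P Q (a ∷ as) (b ∷ bs) with x <ᵇ a
  ... | true  = cong ((y <ᵇ b) ∧_) (cmp≡sameSides x y P Q as bs)
  ... | false = cong (not (y <ᵇ b) ∧_) (cmp≡sameSides x y P Q as bs)

SameSide : ℕ → ℕ → ℕ → ℕ → Set
SameSide x y a b = (x <ᵇ a) ≡ (y <ᵇ b)

T-sameSides : ∀ x y xs ys → T (sameSides x y xs ys) ⇔ Pointwise (SameSide x y) xs ys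
T-sameSides x y [] [] = mk⇔ (λ _ → []) _
T-sameSides x y [] (b ∷ bs) = mk⇔ (λ ()) (λ ())
T-sameSides x y (a ∷ as) [] = mk⇔ (λ ()) (λ ())
T-sameSides x y (a ∷ as) (b ∷ bs) = mk⇔
  (λ t → let (h , r) = Equivalence.to T-∧ t in
         Equivalence.to (T-⇔ᵇ _ _) h ∷ Equivalence.to (T-sameSides x y as bs) r)
  (λ { (h ∷ r) → Equivalence.from T-∧ (Equivalence.from (T-⇔ᵇ _ _) h , Equivalence.from (T-sameSides x y as bs) r) })

infix 4 _≅_
data _≅_ : List ℕ → List ℕ → Set where
  []  : [] ≅ []
  _∷_ : ∀ {x y xs ys} → Pointwise (SameSide x y) xs ys → xs ≅ ys → x ∷ xs ≅ y ∷ ys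

T-sameOrder : ∀ xs ys → T (sameOrder xs ys) ⇔ xs ≅ ys
T-sameOrder [] [] = mk⇔ (λ _ → []) _
T-sameOrder [] (y ∷ ys) = mk⇔ (λ ()) (λ ())
T-sameOrder (x ∷ xs) [] = mk⇔ (λ ()) (λ ())
T-sameOrder (x ∷ xs) (y ∷ ys) rewrite sameOrder-∷ x y xs ys = mk⇔
  (λ t → let (h , r) = Equivalence.to T-∧ t in
         Equivalence.to (T-sameSides x y xs ys) h ∷ Equivalence.to (T-sameOrder xs ys) r)
  (λ { (h ∷ r) → Equivalence.from T-∧ (Equivalence.from (T-sameSides x y xs ys) h , Equivalence.from (T-sameOrder xs ys) r) })

≅-length : ∀ {xs ys} → xs ≅ ys → length xs ≡ length ys
≅-length []      = refl
≅-length (_ ∷ p) = cong suc (≅-length p)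

≅-refl : ∀ xs → xs ≅ xs
≅-refl []       = []
≅-refl (x ∷ xs) = Pointwise.refl refl ∷ ≅-refl xs

≅-sym : ∀ {xs ys} → xs ≅ ys → ys ≅ xs
≅-sym []      = []
≅-sym (p ∷ q) = Pointwise.symmetric sym p ∷ ≅-sym q

≅-trans : ∀ {xs ys zs} → xs ≅ ys → ys ≅ zs → xs ≅ zs
≅-trans []      []        = []
≅-trans (p ∷ q) (p′ ∷ q′) = Pointwise.transitive trans p p′ ∷ ≅-trans q q′

sameOrder-≅ˡ : ∀ {xs ys} zs → xs ≅ ys → sameOrder xs zs ≡ sameOrder ys zs
sameOrder-≅ˡ {xs} {ys} zs p = T-injective
  (λ t → Equivalence.from (T-sameOrder ys zs) (≅-trans (≅-sym p) (Equivalence.to (T-sameOrder xs zs) t)))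
  (λ t → Equivalence.from (T-sameOrder xs zs) (≅-trans p (Equivalence.to (T-sameOrder ys zs) t)))

≅-take : ∀ n {xs ys} → xs ≅ ys → take n xs ≅ take n ys
≅-take zero    _       = []
≅-take (suc n) []      = []
≅-take (suc n) (p ∷ q) = Pointwise-take n p ∷ ≅-take n q
  where
  Pointwise-take : ∀ {R : ℕ → ℕ → Set} n {as bs} → Pointwise R as bs → Pointwise R (take n as) (take n bs)
  Pointwise-take zero    _       = []
  Pointwise-take (suc n) []      = []
  Pointwise-take (suc n) (r ∷ p) = r ∷ Pointwise-take n p

Pointwise-++⁻ : ∀ {R : ℕ → ℕ → Set} ws {xs ys zs} → length ws ≡ length xs →
  Pointwise R (ws ++ ys) (xs ++ zs) → Pointwise R ws xs × Pointwise R ys zs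
Pointwise-++⁻ []       {[]}    _ p       = [] , p
Pointwise-++⁻ (w ∷ ws) {x ∷ xs} e (r ∷ p) = let (p₁ , p₂) = Pointwise-++⁻ ws (suc-injective e) p in r ∷ p₁ , p₂

≅-∷ʳ⁻ : ∀ {v w z c} → v ++ z ∷ [] ≅ w ++ c ∷ [] → v ≅ w × Pointwise (λ a b → (a <ᵇ z) ≡ (b <ᵇ c)) v w
≅-∷ʳ⁻ {[]}    {[]}         _                = [] , []
≅-∷ʳ⁻ {[]}    {b ∷ []}     (_ ∷ ())
≅-∷ʳ⁻ {[]}    {b ∷ _ ∷ _}  (_ ∷ ())
≅-∷ʳ⁻ {a ∷ []}    {[]}     (_ ∷ ())
≅-∷ʳ⁻ {a ∷ _ ∷ _} {[]}     (_ ∷ ())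
≅-∷ʳ⁻ {a ∷ v} {b ∷ w} {z} {c} (p ∷ q) =
  let (q′ , s) = ≅-∷ʳ⁻ q
      (p′ , r) = Pointwise-++⁻ v {ys = z ∷ []} {c ∷ []} (≅-length q′) p
  in p′ ∷ q′ , Pointwise.head r ∷ s

≅-∷ʳ⁺ : ∀ {v w z c} → v ≅ w → Pointwise (λ a b → (a <ᵇ z) ≡ (b <ᵇ c)) v w → v ++ z ∷ [] ≅ w ++ c ∷ []
≅-∷ʳ⁺ []      []      = [] ∷ []
≅-∷ʳ⁺ (p ∷ q) (r ∷ s) = Pointwise.++⁺ p (r ∷ []) ∷ ≅-∷ʳ⁺ q s

≅-ascent : ∀ {xs ys} j → xs ≅ ys → 1 ≤ j → j < length xs →
  (at xs j <ᵇ at xs (suc j)) ≡ (at ys j <ᵇ at ys (suc j))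
≅-ascent (suc zero)    ([] ∷ _)      _ (s≤s ())
≅-ascent (suc zero)    ((r ∷ _) ∷ _) _ _         = r
≅-ascent (suc (suc j)) (_ ∷ q)       _ (s≤s j<) = ≅-ascent (suc j) q (s≤s z≤n) j<

≅-replace-max : ∀ A {T c c′} → All (_< c) (A ++ T) → All (_< c′) (A ++ T) → A ++ c ∷ T ≅ A ++ c′ ∷ T
≅-replace-max []      {T} {c} {c′} T<c T<c′ = peakRow T<c T<c′ ∷ ≅-refl T
  where
  peakRow : ∀ {T} → All (_< c) T → All (_< c′) T → Pointwise (SameSide c c′) T T
  peakRow []            []              = []
  peakRow (t<c ∷ T<c) (t<c′ ∷ T<c′) = trans (<ᵇ-false (<⇒≤ t<c)) (sym (<ᵇ-false (<⇒≤ t<c′))) ∷ peakRow T<c T<c′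
≅-replace-max (a ∷ A) (a<c ∷ A<c) (a<c′ ∷ A<c′) =
  Pointwise.++⁺ (Pointwise.refl refl) (trans (<ᵇ-true a<c) (sym (<ᵇ-true a<c′)) ∷ Pointwise.refl refl)
  ∷ ≅-replace-max A A<c A<c′

Pointwise-below⇔ : ∀ {t z xs ws} → All (_< t) ws → length xs ≡ length ws →
  Pointwise (λ a b → (a <ᵇ z) ≡ (b <ᵇ t)) xs ws ⇔ All (_< z) xs
Pointwise-below⇔ ws<t e = mk⇔ (to ws<t) (from ws<t e)
  where
  to : ∀ {t z xs ws} → All (_< t) ws → Pointwise (λ a b → (a <ᵇ z) ≡ (b <ᵇ t)) xs ws → All (_< z) xs
  to []            []      = []
  to (b<t ∷ ws<t) (r ∷ p) = <ᵇ-true⁻ (trans r (<ᵇ-true b<t)) ∷ to ws<t p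
  from : ∀ {t z xs ws} → All (_< t) ws → length xs ≡ length ws → All (_< z) xs → Pointwise (λ a b → (a <ᵇ z) ≡ (b <ᵇ t)) xs ws
  from {xs = []}    []           _ _             = []
  from {xs = _ ∷ _} (b<t ∷ ws<t) e (a<z ∷ xs<z) = trans (<ᵇ-true a<z) (sym (<ᵇ-true b<t)) ∷ from ws<t (suc-injective e) xs<z

≅-peak : ∀ A {uA c p T uB} → length A ≡ length uA → All (_< p) (uA ++ uB) →
  A ++ c ∷ T ≅ uA ++ p ∷ uB → All (_< c) A × All (_≤ c) T
≅-peak [] {[]} _ u<p (r ∷ _) = [] , below r u<p
  where
  below : ∀ {c p T uB} → Pointwise (SameSide c p) T uB → All (_< p) uB → All (_≤ c) T
  below []      []           = []
  below (r ∷ rs) (b<p ∷ u<p) = <ᵇ-false⁻ (trans r (<ᵇ-false (<⇒≤ b<p))) ∷ below rs u<p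
≅-peak (a ∷ A) {b ∷ uA} {c} {p} {T} {uB} e (b<p ∷ u<p) (r ∷ q) =
  let (A<c , T≤c) = ≅-peak A (suc-injective e) u<p q
      (_ , r′) = Pointwise-++⁻ A {ys = c ∷ T} {p ∷ uB} (suc-injective e) r
  in <ᵇ-true⁻ (trans (Pointwise.head r′) (<ᵇ-true b<p)) ∷ A<c , T≤c

≅-map : ∀ (f : ℕ → ℕ) xs → (∀ {a b} → a ∈ xs → b ∈ xs → (a <ᵇ b) ≡ (f a <ᵇ f b)) → xs ≅ map f xs
≅-map f []       _        = []
≅-map f (x ∷ xs) preserve =
  row xs (λ a∈ → preserve (here refl) (there a∈)) ∷ ≅-map f xs (λ a∈ b∈ → preserve (there a∈) (there b∈))
  where
  row : ∀ ys → (∀ {a} → a ∈ ys → (x <ᵇ a) ≡ (f x <ᵇ f a)) → Pointwise (SameSide x (f x)) ys (map f ys)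
  row []       _ = []
  row (y ∷ ys) p = p (here refl) ∷ row ys (p ∘ there)

-- Occurrences of vincular patterns

-- The candidate occurrences are selected by position masks that depend only on the length,
-- so containment of a pattern depends only on the order pattern of the list.

select : List Bool → List ℕ → List ℕ
select []           _        = []
select (b ∷ bs)     []       = []
select (true ∷ bs)  (x ∷ xs) = x ∷ select bs xs
select (false ∷ bs) (x ∷ xs) = select bs xs

≅-select : ∀ bs {xs ys} → xs ≅ ys → select bs xs ≅ select bs ys
≅-select []           _       = []
≅-select (b ∷ bs)     []      = []
≅-select (true ∷ bs)  (p ∷ q) = Pointwise-select bs p ∷ ≅-select bs q
  where
  Pointwise-select : ∀ {R : ℕ → ℕ → Set} bs {as cs} → Pointwise R as cs → Pointwise R (select bs as) (select bs cs)
  Pointwise-select []           _       = []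
  Pointwise-select (b ∷ bs)     []      = []
  Pointwise-select (true ∷ bs)  (r ∷ p) = r ∷ Pointwise-select bs p
  Pointwise-select (false ∷ bs) (r ∷ p) = Pointwise-select bs p
≅-select (false ∷ bs) (p ∷ q) = ≅-select bs q

mutual
  masksFrom : List Bool → ℕ → List (List Bool)
  masksFrom _            zero    = []
  masksFrom []           (suc n) = (true ∷ replicate n false) ∷ []
  masksFrom (true ∷ as)  (suc n) = map (true ∷_) (masksFrom as n)
  masksFrom (false ∷ as) (suc n) = map (true ∷_) (masksAny as n)

  masksAny : List Bool → ℕ → List (List Bool)
  masksAny as zero    = []
  masksAny as (suc n) = masksFrom as (suc n) ++ map (false ∷_) (masksAny as n)

select-none : ∀ xs → select (replicate (length xs) false) xs ≡ []
select-none []       = refl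
select-none (x ∷ xs) = select-none xs

mutual
  occFrom-masks : ∀ as xs → occFrom as xs ≡ map (λ bs → select bs xs) (masksFrom as (length xs))
  occFrom-masks _            []       = refl
  occFrom-masks []           (x ∷ xs) = cong (λ s → (x ∷ s) ∷ []) (sym (select-none xs))
  occFrom-masks (true ∷ as)  (x ∷ xs) =
    trans (cong (map (x ∷_)) (occFrom-masks as xs)) (trans (sym (map-∘ _)) (map-∘ _))
  occFrom-masks (false ∷ as) (x ∷ xs) =
    trans (cong (map (x ∷_)) (occAny-masks as xs)) (trans (sym (map-∘ _)) (map-∘ _))

  occAny-masks : ∀ as xs → occAny as xs ≡ map (λ bs → select bs xs) (masksAny as (length xs))
  occAny-masks as []       = refl
  occAny-masks as (x ∷ xs) = begin
    occFrom as (x ∷ xs) ++ occAny as xs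
      ≡⟨ cong₂ _++_ (occFrom-masks as (x ∷ xs)) (trans (occAny-masks as xs) (map-∘ (masksAny as (length xs)))) ⟩
    map (λ bs → select bs (x ∷ xs)) (masksFrom as (suc (length xs)))
      ++ map (λ bs → select bs (x ∷ xs)) (map (false ∷_) (masksAny as (length xs)))
      ≡⟨ sym (map-++ _ (masksFrom as (suc (length xs))) _) ⟩
    map (λ bs → select bs (x ∷ xs)) (masksAny as (suc (length xs))) ∎
    where open ≡-Reasoning

contains-masks : ∀ ρ L → contains ρ L ≡ any (λ bs → sameOrder (select bs L) (letters ρ)) (masksAny (adj ρ) (length L))
contains-masks ρ L = trans (cong (any _) (occAny-masks (adj ρ) L)) (cong or (sym (map-∘ (masksAny (adj ρ) (length L)))))

contains-≅ : ∀ ρ {L L′} → L ≅ L′ → contains ρ L ≡ contains ρ L′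
contains-≅ ρ {L} {L′} p = begin
  contains ρ L
    ≡⟨ contains-masks ρ L ⟩
  any (λ bs → sameOrder (select bs L) (letters ρ)) (masksAny (adj ρ) (length L))
    ≡⟨ cong or (map-cong (λ bs → sameOrder-≅ˡ (letters ρ) (≅-select bs p)) (masksAny (adj ρ) (length L))) ⟩
  any (λ bs → sameOrder (select bs L′) (letters ρ)) (masksAny (adj ρ) (length L))
    ≡⟨ cong (λ n → any _ (masksAny (adj ρ) n)) (≅-length p) ⟩
  any (λ bs → sameOrder (select bs L′) (letters ρ)) (masksAny (adj ρ) (length L′))
    ≡⟨ sym (contains-masks ρ L′) ⟩
  contains ρ L′ ∎
  where open ≡-Reasoning

containsAtHead : Vincular → List ℕ → Bool
containsAtHead ρ L = any (λ s → sameOrder s (letters ρ)) (occFrom (adj ρ) L)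

any-++ : ∀ (p : List ℕ → Bool) xs ys → any p (xs ++ ys) ≡ any p xs ∨ any p ys
any-++ p []       ys = refl
any-++ p (x ∷ xs) ys = trans (cong (p x ∨_) (any-++ p xs ys)) (sym (∨-assoc (p x) _ _))

contains-∷ : ∀ ρ x xs → contains ρ (x ∷ xs) ≡ containsAtHead ρ (x ∷ xs) ∨ contains ρ xs
contains-∷ ρ x xs = any-++ _ (occFrom (adj ρ) (x ∷ xs)) (occAny (adj ρ) xs)

dashes : ℕ → List Bool
dashes zero          = []
dashes (suc zero)    = false ∷ []
dashes (suc (suc k)) = true ∷ dashes (suc k)

adj-dashLast : ∀ k σ → adj (dashLast k σ) ≡ dashes k
adj-dashLast zero          σ = refl
adj-dashLast (suc zero)    σ = refl
adj-dashLast (suc (suc k)) σ = cong (true ∷_) (adj-dashLast (suc k) σ)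

occFrom-dashes : ∀ n L → occFrom (dashes (suc n)) L ≡ map (λ z → take (suc n) L ++ z ∷ []) (drop (suc n) L)
occFrom-dashes n       []       = refl
occFrom-dashes zero    (x ∷ xs) = trans (cong (map (x ∷_)) (singletons xs)) (sym (map-∘ xs))
  where
  singletons : ∀ xs → occAny [] xs ≡ map (_∷ []) xs
  singletons []       = refl
  singletons (x ∷ xs) = cong ((x ∷ []) ∷_) (singletons xs)
occFrom-dashes (suc n) (x ∷ xs) = trans (cong (map (x ∷_)) (occFrom-dashes n xs)) (sym (map-∘ (drop (suc n) xs)))

T-containsAtHead-dashLast : ∀ n w c L →
  T (containsAtHead (dashLast (suc n) (w ++ c ∷ [])) L) ⇔
  (take (suc n) L ≅ w × Any (λ z → Pointwise (λ a b → (a <ᵇ z) ≡ (b <ᵇ c)) (take (suc n) L) w) (drop (suc n) L))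
T-containsAtHead-dashLast n w c L
  rewrite adj-dashLast (suc n) (w ++ c ∷ []) | occFrom-dashes n L = mk⇔ to from
  where
  V = take (suc n) L
  to : T (any (λ s → sameOrder s (w ++ c ∷ [])) (map (λ z → V ++ z ∷ []) (drop (suc n) L))) →
       V ≅ w × Any (λ z → Pointwise (λ a b → (a <ᵇ z) ≡ (b <ᵇ c)) V w) (drop (suc n) L)
  to t = proj₁ (≅-∷ʳ⁻ (proj₂ (Any.satisfied hit))) , Any.map (λ s → proj₂ (≅-∷ʳ⁻ s)) hit
    where
    hit : Any (λ z → V ++ z ∷ [] ≅ w ++ c ∷ []) (drop (suc n) L)
    hit = Any.map (Equivalence.to (T-sameOrder _ _)) (Anyₚ.map⁻ (Equivalence.from any⇔ t))
  from : V ≅ w × Any (λ z → Pointwise (λ a b → (a <ᵇ z) ≡ (b <ᵇ c)) V w) (drop (suc n) L) →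
         T (any (λ s → sameOrder s (w ++ c ∷ [])) (map (λ z → V ++ z ∷ []) (drop (suc n) L)))
  from (p , hit) = Equivalence.to any⇔ (Anyₚ.map⁺ (Any.map (λ r → Equivalence.from (T-sameOrder _ _) (≅-∷ʳ⁺ p r)) hit))

Avoids : Vincular → List ℕ → Set
Avoids ρ L = ¬ T (contains ρ L)

avoids-∷⁻ : ∀ ρ {x xs} → Avoids ρ (x ∷ xs) → ¬ T (containsAtHead ρ (x ∷ xs)) × Avoids ρ xs
avoids-∷⁻ ρ {x} {xs} a rewrite contains-∷ ρ x xs = a ∘ Equivalence.from T-∨ ∘ inj₁ , a ∘ Equivalence.from T-∨ ∘ inj₂

avoids-∷⁺ : ∀ ρ {x xs} → ¬ T (containsAtHead ρ (x ∷ xs)) → Avoids ρ xs → Avoids ρ (x ∷ xs)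
avoids-∷⁺ ρ {x} {xs} ¬h a rewrite contains-∷ ρ x xs = [ ¬h , a ]′ ∘ Equivalence.to T-∨

avoids-drop : ∀ ρ n {L} → Avoids ρ L → Avoids ρ (drop n L)
avoids-drop ρ zero    a = a
avoids-drop ρ (suc n) {[]}    a = a
avoids-drop ρ (suc n) {x ∷ L} a = avoids-drop ρ n (proj₂ (avoids-∷⁻ ρ a))

avoids-≅ : ∀ ρ {L L′} → L ≅ L′ → Avoids ρ L → Avoids ρ L′
avoids-≅ ρ p a = a ∘ subst T (sym (contains-≅ ρ p))

avoids-from : ∀ ρ n L → (∀ j → j < n → ¬ T (containsAtHead ρ (drop j L))) → Avoids ρ (drop n L) → Avoids ρ L
avoids-from ρ zero    L       _   a = a
avoids-from ρ (suc n) []      _   a = a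
avoids-from ρ (suc n) (x ∷ L) ¬hs a = avoids-∷⁺ ρ (¬hs 0 (s≤s z≤n)) (avoids-from ρ n L (λ j j<n → ¬hs (suc j) (s≤s j<n)) a)

take-++ : ∀ {X : Set} n (xs ys : List X) → length xs ≡ n → take n (xs ++ ys) ≡ xs
take-++ zero    []       ys _ = refl
take-++ (suc n) (x ∷ xs) ys e = cong (x ∷_) (take-++ n xs ys (suc-injective e))

drop-++ : ∀ {X : Set} n (xs ys : List X) → length xs ≡ n → drop n (xs ++ ys) ≡ ys
drop-++ zero    []       ys _ = refl
drop-++ (suc n) (x ∷ xs) ys e = drop-++ n xs ys (suc-injective e)

take-window : ∀ {X : Set} n p (xs : List X) y ys → length xs ≡ n → take (suc (n + p)) (xs ++ y ∷ ys) ≡ xs ++ y ∷ take p ys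
take-window zero    p []       y ys _ = refl
take-window (suc n) p (x ∷ xs) y ys e = cong (x ∷_) (take-window n p xs y ys (suc-injective e))

drop-window : ∀ {X : Set} n p (xs : List X) y ys → length xs ≡ n → drop (suc (n + p)) (xs ++ y ∷ ys) ≡ drop p ys
drop-window zero    p []       y ys _ = refl
drop-window (suc n) p (x ∷ xs) y ys e = drop-window n p xs y ys (suc-injective e)

split : ∀ {X : Set} n (zs : List X) → n < length zs → ∃ λ xs → ∃ λ y → ∃ λ ys → zs ≡ xs ++ y ∷ ys × length xs ≡ n
split zero    (z ∷ zs) _        = [] , z , zs , refl , refl
split (suc n) (z ∷ zs) (s≤s n<) with split n zs n<
... | xs , y , ys , refl , e = z ∷ xs , y , ys , refl , cong suc e

at-take : ∀ n (L : List ℕ) j → j ≤ n → at (take n L) j ≡ at L j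
at-take zero    []      zero          _       = refl
at-take zero    (x ∷ L) zero          _       = refl
at-take (suc n) []      j             _       = refl
at-take (suc n) (x ∷ L) zero          _       = refl
at-take (suc n) (x ∷ L) (suc zero)    _       = refl
at-take (suc n) (x ∷ L) (suc (suc j)) (s≤s p) = at-take n L (suc j) p

at-drop : ∀ d (L : List ℕ) j → at (drop d L) (suc j) ≡ at L (suc (d + j))
at-drop zero    L       j = refl
at-drop (suc d) []      j = refl
at-drop (suc d) (x ∷ L) j = at-drop d L j

drop-suc-++ : ∀ {X : Set} n (xs : List X) y ys → length xs ≡ n → drop (suc n) (xs ++ y ∷ ys) ≡ ys
drop-suc-++ zero    []       y ys _ = refl
drop-suc-++ (suc n) (x ∷ xs) y ys e = drop-suc-++ n xs y ys (suc-injective e)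

at-∈ : ∀ {z} (L : List ℕ) → z ∈ L → ∃ λ j → 1 ≤ j × j ≤ length L × at L j ≡ z
at-∈ (x ∷ L) (here refl) = 1 , s≤s z≤n , s≤s z≤n , refl
at-∈ (x ∷ L) (there z∈) with at-∈ L z∈
... | suc j , 1≤j , j≤ , e = suc (suc j) , s≤s z≤n , s≤s j≤ , e

∈-at : ∀ (L : List ℕ) j → 1 ≤ j → j ≤ length L → at L j ∈ L
∈-at (x ∷ L) (suc zero)    _ _          = here refl
∈-at (x ∷ L) (suc (suc j)) _ (s≤s j<) = there (∈-at L (suc j) (s≤s z≤n) j<)

split-at : ∀ n (L : List ℕ) → n < length L → L ≡ take n L ++ at L (suc n) ∷ drop (suc n) L
split-at zero    (x ∷ L) _        = refl
split-at (suc n) (x ∷ L) (s≤s n<) = cong (x ∷_) (split-at n L n<)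

∈-drop : ∀ {X : Set} n {xs : List X} {z} → z ∈ drop n xs → z ∈ xs
∈-drop n {xs} z∈ = subst (_ ∈_) (take++drop≡id n xs) (∈-++⁺ʳ (take n xs) z∈)

Unique-++ʳ : ∀ {X : Set} (xs : List X) {ys} → Unique (xs ++ ys) → Unique ys
Unique-++ʳ []       u       = u
Unique-++ʳ (x ∷ xs) (_ ∷ u) = Unique-++ʳ xs u

Unique-head : ∀ {X : Set} {x : X} {xs} → Unique (x ∷ xs) → x ∉ xs
Unique-head (x≢ ∷ _) x∈ = All.lookup x≢ x∈ refl

Unique-disjoint : ∀ {X : Set} (xs : List X) {ys} → Unique (xs ++ ys) → ∀ {z} → z ∈ xs → z ∉ ys
Unique-disjoint (x ∷ xs) (x≢ ∷ _) (here refl) z∈ys = All.lookup x≢ (∈-++⁺ʳ xs z∈ys) refl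
Unique-disjoint (x ∷ xs) (_ ∷ u)  (there z∈xs) z∈ys = Unique-disjoint xs u z∈xs z∈ys

Unique-∷-⊆ : ∀ {X : Set} {x : X} {xs ys} → Unique (x ∷ xs) → ys ⊆ xs → Unique ys → Unique (x ∷ ys)
Unique-∷-⊆ (x≢ ∷ _) ys⊆xs uys = All.tabulate (All.lookup x≢ ∘ ys⊆xs) ∷ uys

Unique-insert : ∀ {X : Set} (P : List X) {Q s} → Unique (P ++ Q) → s ∉ P ++ Q → Unique (P ++ s ∷ Q)
Unique-insert []      u        s∉ = All.tabulate (λ z∈ s≡z → s∉ (subst (_∈ _) (sym s≡z) z∈)) ∷ u
Unique-insert (p ∷ P) (p≢ ∷ u) s∉ =
  ++⁺ (++⁻ˡ P p≢) ((λ p≡s → s∉ (here (sym p≡s))) ∷ ++⁻ʳ P p≢) ∷ Unique-insert P u (s∉ ∘ there)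

drop-⊆ : ∀ {X : Set} n {L L′ : List X} → take n L ≡ take n L′ → L′ ⊆ L → Unique L′ → drop n L′ ⊆ drop n L
drop-⊆ n {L} {L′} tk L′⊆L uq {z} z∈ with ∈-++⁻ (take n L) (subst (z ∈_) (sym (take++drop≡id n L)) (L′⊆L (∈-drop n z∈)))
... | inj₂ z∈drop = z∈drop
... | inj₁ z∈take = contradiction z∈
  (Unique-disjoint (take n L′) (subst Unique (sym (take++drop≡id n L′)) uq) (subst (z ∈_) tk z∈take))

pigeonhole : ∀ {X : Set} {S L : List X} → Unique S → S ⊆ L → length L ≤ length S → Unique L × L ⊆ S
pigeonhole {S = []}    {[]} _         _    _ = [] , λ ()
pigeonhole {S = s ∷ S} {L}  (s≢ ∷ uS) S⊆L len with ∈-∃++ (S⊆L (here refl))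
... | P , Q , refl = Unique-insert P uPQ s∉ , back
  where
  S⊆PQ : S ⊆ P ++ Q
  S⊆PQ {z} z∈ with ∈-++⁻ P (S⊆L (there z∈))
  ... | inj₁ z∈P           = ∈-++⁺ˡ z∈P
  ... | inj₂ (here refl)   = contradiction refl (All.lookup s≢ z∈)
  ... | inj₂ (there z∈Q)   = ∈-++⁺ʳ P z∈Q
  len′ : length (P ++ Q) ≤ length S
  len′ = ≤-pred (subst (_≤ suc (length S)) (trans (length-++ P) (trans (+-suc (length P) (length Q)) (cong suc (sym (length-++ P))))) len)
  ih = pigeonhole uS S⊆PQ len′
  uPQ = proj₁ ih
  s∉ : s ∉ P ++ Q
  s∉ s∈ = contradiction refl (All.lookup s≢ (proj₂ ih s∈))
  back : P ++ s ∷ Q ⊆ s ∷ S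
  back z∈ with ∈-++⁻ P z∈
  ... | inj₁ z∈P         = there (proj₂ ih (∈-++⁺ˡ z∈P))
  ... | inj₂ (here refl) = here refl
  ... | inj₂ (there z∈Q) = there (proj₂ ih (∈-++⁺ʳ P z∈Q))

oneTo-unique : ∀ n → Unique (oneTo n)
oneTo-unique n = Uniqueₚ.map⁺ suc-injective (Uniqueₚ.upTo⁺ n)

oneTo-length : ∀ n → length (oneTo n) ≡ n
oneTo-length n = trans (length-map suc (upTo n)) (length-upTo n)

∈-oneTo⁻ : ∀ {n z} → z ∈ oneTo n → 1 ≤ z × z ≤ n
∈-oneTo⁻ z∈ with ∈-map⁻ suc z∈
... | j , j∈ , refl = s≤s z≤n , ∈-upTo⁻ j∈

T-elem : ∀ j π → T (elem j π) ⇔ j ∈ π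
T-elem j π = mk⇔ (Any.map (≡ᵇ⇒≡ j _) ∘ Anyₚ.any⁻ _ π) (Anyₚ.any⁺ _ ∘ Any.map (≡⇒≡ᵇ j _))

T-isPerm : ∀ n π → T (isPerm n π) ⇔ (length π ≡ n × oneTo n ⊆ π)
T-isPerm n π = mk⇔
  (λ t → let (l , a) = Equivalence.to T-∧ t in
         ≡ᵇ⇒≡ _ _ l , λ {j} j∈ → Equivalence.to (T-elem j π) (All.lookup (Allₚ.all⁺ _ (oneTo n) a) j∈))
  (λ (l , ⊆π) → Equivalence.from T-∧
    (≡⇒≡ᵇ _ _ l , Allₚ.all⁻ _ (All.tabulate (λ {j} j∈ → Equivalence.from (T-elem j π) (⊆π j∈)))))

isPerm-unique : ∀ {n π} → T (isPerm n π) → Unique π × π ⊆ oneTo n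
isPerm-unique {n} {π} t = let (l , ⊆π) = Equivalence.to (T-isPerm n π) t in
  pigeonhole (oneTo-unique n) ⊆π (≤-reflexive (trans l (sym (oneTo-length n))))

isPerm-resp : ∀ {n π π′} → π ⊆ π′ → length π ≡ length π′ → T (isPerm n π) → T (isPerm n π′)
isPerm-resp {n} {π} {π′} π⊆ l t = let (l′ , ⊆π) = Equivalence.to (T-isPerm n π) t in
  Equivalence.from (T-isPerm n π′) (trans (sym l) l′ , π⊆ ∘ ⊆π)

Σ-T-↔ : ∀ {P Q : List ℕ → Bool} (f g : List ℕ → List ℕ) →
  (∀ {π} → T (P π) → T (Q (f π)) × g (f π) ≡ π) → (∀ {π} → T (Q π) → T (P (g π)) × f (g π) ≡ π) →
  Σ (List ℕ) (T ∘ P) ↔ Σ (List ℕ) (T ∘ Q)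
Σ-T-↔ {P} {Q} f g f-ok g-ok = mk↔ₛ′ to from (λ (π , t) → Σ-≡ (proj₂ (g-ok t))) (λ (π , t) → Σ-≡ (proj₂ (f-ok t)))
  where
  to : Σ (List ℕ) (T ∘ P) → Σ (List ℕ) (T ∘ Q)
  to (π , t) = f π , proj₁ (f-ok t)
  from : Σ (List ℕ) (T ∘ Q) → Σ (List ℕ) (T ∘ P)
  from (π , t) = g π , proj₁ (g-ok t)
  Σ-≡ : ∀ {R : List ℕ → Bool} {π π′} {t : T (R π)} {t′ : T (R π′)} → π ≡ π′ → (π , t) ≡ (π′ , t′)
  Σ-≡ {t = t} {t′} refl = cong (_ ,_) (T-irrelevant t t′)

Transfers : Vincular → Vincular → (List ℕ → List ℕ) → (List ℕ → List ℕ) → Set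
Transfers ρ ρ′ f g = ∀ {n π} → T (isPerm n π) → Avoids ρ π →
  T (isPerm n (f π)) × Avoids ρ′ (f π) × at (f π) 1 ≡ at π 1 × g (f π) ≡ π

module _ {ρ ρ′ : Vincular} (f g : List ℕ → List ℕ) (f-ok : Transfers ρ ρ′ f g) (g-ok : Transfers ρ′ ρ g f) where

  Av-↔ : ∀ n → Av ρ n ↔ Av ρ′ n
  Av-↔ n = Σ-T-↔ f g (restrict {ρ} {ρ′} {f} {g} f-ok) (restrict {ρ′} {ρ} {g} {f} g-ok)
    where
    restrict : ∀ {r r′ : Vincular} {h h′ : List ℕ → List ℕ} → Transfers r r′ h h′ → ∀ {π} →
               T (isPerm n π ∧ not (contains r π)) → T (isPerm n (h π) ∧ not (contains r′ (h π))) × h′ (h π) ≡ π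
    restrict ok t with Equivalence.to T-∧ t
    ... | p , a with ok p (Equivalence.to T-not a)
    ...   | p′ , a′ , _ , inv = Equivalence.from T-∧ (p′ , Equivalence.from T-not a′) , inv

  AvFirst-↔ : ∀ n a → AvFirst ρ n a ↔ AvFirst ρ′ n a
  AvFirst-↔ n a = Σ-T-↔ f g (restrict {ρ} {ρ′} {f} {g} f-ok) (restrict {ρ′} {ρ} {g} {f} g-ok)
    where
    restrict : ∀ {r r′ : Vincular} {h h′ : List ℕ → List ℕ} → Transfers r r′ h h′ → ∀ {π} →
               T (isPerm n π ∧ not (contains r π) ∧ (at π 1 ≡ᵇ a)) →
               T (isPerm n (h π) ∧ not (contains r′ (h π)) ∧ (at (h π) 1 ≡ᵇ a)) × h′ (h π) ≡ π
    restrict ok t with Equivalence.to T-∧ t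
    ... | p , t′ with Equivalence.to T-∧ t′
    ...   | a′ , first with ok p (Equivalence.to T-not a′)
    ...     | p″ , a″ , same-first , inv =
      Equivalence.from T-∧ (p″ , Equivalence.from T-∧ (Equivalence.from T-not a″ , subst (λ h → T (h ≡ᵇ a)) (sym same-first) first))
      , inv

-- The cyclic successor in a finite set of values

data CyclicSucc (S : List ℕ) (v w : ℕ) : Set where
  step : v ∈ S → w ∈ S → v < w → (∀ {s} → s ∈ S → v < s → w ≤ s) → CyclicSucc S v w
  wrap : v ∈ S → w ∈ S → (∀ {s} → s ∈ S → s ≤ v) → (∀ {s} → s ∈ S → w ≤ s) → CyclicSucc S v w

CyclicSucc-∈ˡ : ∀ {S v w} → CyclicSucc S v w → v ∈ S
CyclicSucc-∈ˡ (step v∈ _ _ _) = v∈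
CyclicSucc-∈ˡ (wrap v∈ _ _ _) = v∈

CyclicSucc-∈ʳ : ∀ {S v w} → CyclicSucc S v w → w ∈ S
CyclicSucc-∈ʳ (step _ w∈ _ _) = w∈
CyclicSucc-∈ʳ (wrap _ w∈ _ _) = w∈

module _ {S : List ℕ} where

  CyclicSucc-functional : ∀ {v w w′} → CyclicSucc S v w → CyclicSucc S v w′ → w ≡ w′
  CyclicSucc-functional (step _ w∈ v<w l) (step _ w′∈ v<w′ l′) = ≤-antisym (l w′∈ v<w′) (l′ w∈ v<w)
  CyclicSucc-functional (step _ w∈ v<w _) (wrap _ _ top _)      = contradiction (top w∈) (<⇒≱ v<w)
  CyclicSucc-functional (wrap _ _ top _)  (step _ w′∈ v<w′ _)   = contradiction (top w′∈) (<⇒≱ v<w′)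
  CyclicSucc-functional (wrap _ w∈ _ bot) (wrap _ w′∈ _ bot′)   = ≤-antisym (bot w′∈) (bot′ w∈)

  CyclicSucc-injective : ∀ {v v′ w} → CyclicSucc S v w → CyclicSucc S v′ w → v ≡ v′
  CyclicSucc-injective {v} {v′} (step v∈ _ v<w l) (step v′∈ _ v′<w l′) with <-cmp v v′
  ... | tri< v<v′ _ _ = contradiction (l v′∈ v<v′) (<⇒≱ v′<w)
  ... | tri≈ _ v≡v′ _ = v≡v′
  ... | tri> _ _ v′<v = contradiction (l′ v∈ v′<v) (<⇒≱ v<w)
  CyclicSucc-injective (step v∈ _ v<w _) (wrap _ _ _ bot) = contradiction (bot v∈) (<⇒≱ v<w)
  CyclicSucc-injective (wrap _ _ _ bot) (step v′∈ _ v′<w _) = contradiction (bot v′∈) (<⇒≱ v′<w)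
  CyclicSucc-injective (wrap v∈ _ top _) (wrap v′∈ _ top′ _) = ≤-antisym (top′ v∈) (top v′∈)

  CyclicSucc-least : ∀ {v w} → CyclicSucc S v w → v < w → ∀ {s} → s ∈ S → v < s → w ≤ s
  CyclicSucc-least (step _ _ _ l)     _   = l
  CyclicSucc-least (wrap _ w∈ top bot) v<w = contradiction (≤-trans (bot w∈) (top w∈)) (<⇒≱ v<w)

  CyclicSucc-<ᵇ : ∀ {v w v′ w′} → CyclicSucc S v w → CyclicSucc S v′ w′ → v < w → v′ < w′ →
                  (v <ᵇ v′) ≡ (w <ᵇ w′)
  CyclicSucc-<ᵇ {v} {w} {v′} {w′} s s′ v<w v′<w′ with <-cmp v v′
  ... | tri< v<v′ _ _ = trans (<ᵇ-true v<v′) (sym (<ᵇ-true (≤-<-trans (CyclicSucc-least s v<w (CyclicSucc-∈ˡ s′) v<v′) v′<w′)))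
  ... | tri≈ _ refl _ = trans (<ᵇ-false {v} ≤-refl) (sym (<ᵇ-false (≤-reflexive (CyclicSucc-functional s′ s))))
  ... | tri> _ _ v′<v = trans (<ᵇ-false (<⇒≤ v′<v))
                          (sym (<ᵇ-false (<⇒≤ (≤-<-trans (CyclicSucc-least s′ v′<w′ (CyclicSucc-∈ˡ s) v′<v) v<w))))

-- Kept abstract: unfolding the extrema makes the goals about cycleNext and cyclePrev very large.
abstract
  least greatest : ℕ → List ℕ → ℕ
  least    = min
  greatest = max

  least-all : ∀ {P : ℕ → Set} {t xs} → P t → All P xs → P (least t xs)
  least-all = argmin-all id

  greatest-all : ∀ {P : ℕ → Set} {t xs} → P t → All P xs → P (greatest t xs)
  greatest-all = argmax-all id

  least-≤ : ∀ t xs → All (least t xs ≤_) xs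
  least-≤ = min≤xs

  ≤-greatest : ∀ t xs → All (_≤ greatest t xs) xs
  ≤-greatest = xs≤max

  least-sel : ∀ t xs → least t xs ≡ t ⊎ least t xs ∈ xs
  least-sel = argmin-sel id

  greatest-sel : ∀ t xs → greatest t xs ≡ t ⊎ greatest t xs ∈ xs
  greatest-sel = argmax-sel id

-- The least entry of S above v, or the least entry of S if there is none; the identity outside S.
-- In the minimum over the entries above v, greatest v S is a default that is itself such an entry.
cycleNext : List ℕ → ℕ → ℕ
cycleNext S v with v ∈? S | v <? greatest v S
... | no _  | _     = v
... | yes _ | yes _ = least (greatest v S) (filter (v <?_) S)
... | yes _ | no _  = least v S

cyclePrev : List ℕ → ℕ → ℕ
cyclePrev S w with w ∈? S | least w S <? w
... | no _  | _     = w
... | yes _ | yes _ = greatest (least w S) (filter (_<? w) S)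
... | yes _ | no _  = greatest w S

module _ {S : List ℕ} where

  cycleNext-∉ : ∀ {v} → v ∉ S → cycleNext S v ≡ v
  cycleNext-∉ {v} v∉ with v ∈? S | v <? greatest v S
  ... | no _   | _ = refl
  ... | yes v∈ | _ = contradiction v∈ v∉

  cyclePrev-∉ : ∀ {w} → w ∉ S → cyclePrev S w ≡ w
  cyclePrev-∉ {w} w∉ with w ∈? S | least w S <? w
  ... | no _   | _ = refl
  ... | yes w∈ | _ = contradiction w∈ w∉

  private
    greatest∈ : ∀ {v} → v < greatest v S → greatest v S ∈ S
    greatest∈ {v} v<greatest with greatest-sel v S
    ... | inj₁ greatest≡v = contradiction (subst (v <_) greatest≡v v<greatest) (<-irrefl refl)
    ... | inj₂ greatest∈S = greatest∈S

    least∈ : ∀ {w} → least w S < w → least w S ∈ S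
    least∈ {w} least<w with least-sel w S
    ... | inj₁ least≡w = contradiction (subst (_< w) least≡w least<w) (<-irrefl refl)
    ... | inj₂ least∈S = least∈S

  cycleNext-spec : ∀ {v} → v ∈ S → CyclicSucc S v (cycleNext S v)
  cycleNext-spec {v} v∈ with v ∈? S | v <? greatest v S
  ... | no v∉ | _ = contradiction v∈ v∉
  ... | yes _ | yes v<greatest = step v∈ (proj₁ above) (proj₂ above)
      (λ s∈ v<s → All.lookup (least-≤ (greatest v S) (filter (v <?_) S)) (∈-filter⁺ (v <?_) s∈ v<s))
    where
    above : least (greatest v S) (filter (v <?_) S) ∈ S × v < least (greatest v S) (filter (v <?_) S)
    above = least-all {P = λ t → t ∈ S × v < t} (greatest∈ v<greatest , v<greatest) (All.tabulate (∈-filter⁻ (v <?_)))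
  ... | yes _ | no v≮greatest = wrap v∈ (least-all {P = _∈ S} v∈ (All.tabulate id))
      (λ s∈ → ≤-trans (All.lookup (≤-greatest v S) s∈) (≮⇒≥ v≮greatest)) (All.lookup (least-≤ v S))

  cyclePrev-spec : ∀ {w} → w ∈ S → CyclicSucc S (cyclePrev S w) w
  cyclePrev-spec {w} w∈ with w ∈? S | least w S <? w
  ... | no w∉ | _ = contradiction w∈ w∉
  ... | yes _ | yes least<w = step (proj₁ below) w∈ (proj₂ below) minimal
    where
    below : greatest (least w S) (filter (_<? w) S) ∈ S × greatest (least w S) (filter (_<? w) S) < w
    below = greatest-all {P = λ t → t ∈ S × t < w} (least∈ least<w , least<w) (All.tabulate (∈-filter⁻ (_<? w)))
    minimal : ∀ {s} → s ∈ S → greatest (least w S) (filter (_<? w) S) < s → w ≤ s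
    minimal {s} s∈ p<s with s <? w
    ... | yes s<w = contradiction (All.lookup (≤-greatest (least w S) (filter (_<? w) S)) (∈-filter⁺ (_<? w) s∈ s<w)) (<⇒≱ p<s)
    ... | no s≮w = ≮⇒≥ s≮w
  ... | yes _ | no least≮w = wrap (greatest-all {P = _∈ S} w∈ (All.tabulate id)) w∈
      (All.lookup (≤-greatest w S)) (λ s∈ → ≤-trans (≮⇒≥ least≮w) (All.lookup (least-≤ w S) s∈))

CyclicSucc-resp : ∀ {S S′ v w} → S ⊆ S′ → S′ ⊆ S → CyclicSucc S v w → CyclicSucc S′ v w
CyclicSucc-resp S⊆ S′⊆ (step v∈ w∈ v<w l)   = step (S⊆ v∈) (S⊆ w∈) v<w (λ s∈ → l (S′⊆ s∈))
CyclicSucc-resp S⊆ S′⊆ (wrap v∈ w∈ top bot) = wrap (S⊆ v∈) (S⊆ w∈) (λ s∈ → top (S′⊆ s∈)) (λ s∈ → bot (S′⊆ s∈))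

module _ {S S′ : List ℕ} (S⊆S′ : S ⊆ S′) (S′⊆S : S′ ⊆ S) where

  cyclePrev-cycleNext : ∀ v → cyclePrev S′ (cycleNext S v) ≡ v
  cyclePrev-cycleNext v = by-cases (v ∈? S)
    where
    by-cases : Dec (v ∈ S) → cyclePrev S′ (cycleNext S v) ≡ v
    by-cases (no v∉)  = trans (cong (cyclePrev S′) (cycleNext-∉ v∉)) (cyclePrev-∉ (λ v∈ → v∉ (S′⊆S v∈)))
    by-cases (yes v∈) = sym (CyclicSucc-injective s (cyclePrev-spec (CyclicSucc-∈ʳ s)))
      where s = CyclicSucc-resp S⊆S′ S′⊆S (cycleNext-spec v∈)

  cycleNext-cyclePrev : ∀ w → cycleNext S′ (cyclePrev S w) ≡ w
  cycleNext-cyclePrev w = by-cases (w ∈? S)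
    where
    by-cases : Dec (w ∈ S) → cycleNext S′ (cyclePrev S w) ≡ w
    by-cases (no w∉)  = trans (cong (cycleNext S′) (cyclePrev-∉ w∉)) (cycleNext-∉ (λ w∈ → w∉ (S′⊆S w∈)))
    by-cases (yes w∈) = sym (CyclicSucc-functional s (cycleNext-spec (CyclicSucc-∈ˡ s)))
      where s = CyclicSucc-resp S⊆S′ S′⊆S (cyclePrev-spec w∈)

record PermutationOn (S : List ℕ) (f : ℕ → ℕ) : Set where
  field
    inverse : ℕ → ℕ
    closed  : ∀ {v} → v ∈ S → f v ∈ S
    fixes   : ∀ {v} → v ∉ S → f v ≡ v
    left    : ∀ v → inverse (f v) ≡ v
    right   : ∀ v → f (inverse v) ≡ v

  inverse-closed : ∀ {v} → v ∈ S → inverse v ∈ S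
  inverse-closed {v} v∈ with inverse v ∈? S
  ... | yes p = p
  ... | no p  = contradiction (subst (_∈ S) (trans (sym (right v)) (fixes p)) v∈) p

  inverse-fixes : ∀ {v} → v ∉ S → inverse v ≡ v
  inverse-fixes {v} v∉ with inverse v ∈? S
  ... | yes p = contradiction (subst (_∈ S) (right v) (closed p)) v∉
  ... | no p  = trans (sym (fixes p)) (right v)

  map-⊆ : ∀ {L} → S ⊆ L → map f L ⊆ L
  map-⊆ {L} S⊆L z∈ with ∈-map⁻ f z∈
  ... | d , d∈ , refl with d ∈? S
  ...   | yes p = S⊆L (closed p)
  ...   | no p  = subst (_∈ L) (sym (fixes p)) d∈

  ⊆-map : ∀ {L} → S ⊆ L → L ⊆ map f L
  ⊆-map {L} S⊆L {z} z∈ = subst (_∈ map f L) (right z) (∈-map⁺ f pre∈)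
    where
    pre∈ : inverse z ∈ L
    pre∈ with z ∈? S
    ... | yes p = S⊆L (inverse-closed p)
    ... | no p  = subst (_∈ L) (sym (inverse-fixes p)) z∈

  map-unique : ∀ {L} → Unique L → Unique (map f L)
  map-unique = Uniqueₚ.map⁺ (λ {x} {y} e → trans (sym (left x)) (trans (cong inverse e) (left y)))

cycleNext-permutation : ∀ S → PermutationOn S (cycleNext S)
cycleNext-permutation S = record
  { inverse = cyclePrev S
  ; closed  = CyclicSucc-∈ʳ ∘ cycleNext-spec
  ; fixes   = cycleNext-∉
  ; left    = cyclePrev-cycleNext {S} {S} id id
  ; right   = cycleNext-cyclePrev {S} {S} id id
  }

cyclePrev-permutation : ∀ S → PermutationOn S (cyclePrev S)
cyclePrev-permutation S = record
  { inverse = cycleNext S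
  ; closed  = CyclicSucc-∈ˡ ∘ cyclePrev-spec
  ; fixes   = cyclePrev-∉
  ; left    = cycleNext-cyclePrev {S} {S} id id
  ; right   = cyclePrev-cycleNext {S} {S} id id
  }

-- Rotating the peak values of a window

module Rotation (N : List ℕ) where

  Big : ℕ → Set
  Big z = All (_< z) N

  big? : Decidable Big
  big? z = All.all? (_<? z) N

  small<big : ∀ {a b} → ¬ Big a → Big b → a < b
  small<big {a} {b} = go N
    where
    go : ∀ M → ¬ All (_< a) M → All (_< b) M → a < b
    go []      ¬p _          = contradiction [] ¬p
    go (n ∷ M) ¬p (n<b ∷ q) with n <? a
    ... | yes n<a = go M (¬p ∘ (n<a ∷_)) q
    ... | no n≮a  = ≤-<-trans (≮⇒≥ n≮a) n<b

  peakValues : List ℕ → List ℕ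
  peakValues []      = []
  peakValues (c ∷ D) = c ∷ filter big? D

  rotate : List ℕ → List ℕ
  rotate L = map (cycleNext (peakValues L)) L

  unrotate : List ℕ → List ℕ
  unrotate L = map (cyclePrev (peakValues L)) L

  peakValues-⊆ : ∀ L → peakValues L ⊆ L
  peakValues-⊆ (c ∷ D) (here refl) = here refl
  peakValues-⊆ (c ∷ D) (there z∈) = there (proj₁ (∈-filter⁻ big? {xs = D} z∈))

  module AtPeak {c : ℕ} {D : List ℕ} (bc : Big c) where

    private
      S = peakValues (c ∷ D)

    peakValues-big : ∀ {s} → s ∈ S → Big s
    peakValues-big (here refl) = bc
    peakValues-big (there s∈) = proj₂ (∈-filter⁻ big? {xs = D} s∈)

    small-∉ : ∀ {z} → ¬ Big z → z ∉ S
    small-∉ ¬bz = ¬bz ∘ peakValues-big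

    ∈D-∉-small : ∀ {z} → z ∈ D → z ∉ S → ¬ Big z
    ∈D-∉-small z∈ z∉ bz = z∉ (there (∈-filter⁺ big? z∈ bz))

    module _ {f} (perm : PermutationOn S f) where
      open PermutationOn perm

      peakValues-map-⊆ : peakValues (map f (c ∷ D)) ⊆ S
      peakValues-map-⊆ (here refl) = closed (here refl)
      peakValues-map-⊆ (there z∈) with ∈-filter⁻ big? {xs = map f D} z∈
      ... | z∈fD , bz with ∈-map⁻ f z∈fD
      ...   | d , d∈ , refl with d ∈? S
      ...     | yes p = closed p
      ...     | no p  = contradiction (there (∈-filter⁺ big? d∈ (subst Big (fixes p) bz))) p

      ⊆-peakValues-map : S ⊆ peakValues (map f (c ∷ D))
      ⊆-peakValues-map {s} s∈ = subst (_∈ peakValues (map f (c ∷ D))) (right s) (image (inverse-closed s∈))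
        where
        image : inverse s ∈ S → f (inverse s) ∈ peakValues (map f (c ∷ D))
        image (here e)  = here (cong f e)
        image (there p) = there (∈-filter⁺ big? (∈-map⁺ f (proj₁ (∈-filter⁻ big? {xs = D} p)))
                                             (subst Big (sym (right s)) (peakValues-big s∈)))

      map-fixes-small : ∀ {T} → All (¬_ ∘ Big) T → map f T ≡ T
      map-fixes-small = map-id-local ∘ All.map (fixes ∘ small-∉)

      ≅-map-peakValues : (∀ {a b} → a ∈ D → b ∈ D → a ∈ S → b ∈ S → (a <ᵇ b) ≡ (f a <ᵇ f b)) → D ≅ map f D
      ≅-map-peakValues onS = ≅-map f D preserve
        where
        preserve : ∀ {a b} → a ∈ D → b ∈ D → (a <ᵇ b) ≡ (f a <ᵇ f b)
        preserve {a} {b} a∈ b∈ with a ∈? S | b ∈? S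
        ... | yes p | yes q = onS a∈ b∈ p q
        ... | no p  | no q  = sym (cong₂ _<ᵇ_ (fixes p) (fixes q))
        ... | no p  | yes q rewrite fixes p =
          trans (<ᵇ-true (small<big (∈D-∉-small a∈ p) (peakValues-big q)))
                (sym (<ᵇ-true (small<big (∈D-∉-small a∈ p) (peakValues-big (closed q)))))
        ... | yes p | no q  rewrite fixes q =
          trans (<ᵇ-false (<⇒≤ (small<big (∈D-∉-small b∈ q) (peakValues-big p))))
                (sym (<ᵇ-false (<⇒≤ (small<big (∈D-∉-small b∈ q) (peakValues-big (closed p))))))

    unrotate-rotate : unrotate (rotate (c ∷ D)) ≡ c ∷ D
    unrotate-rotate = trans (sym (map-∘ (c ∷ D)))
      (trans (map-cong (cyclePrev-cycleNext (⊆-peakValues-map perm) (peakValues-map-⊆ perm)) (c ∷ D)) (map-id (c ∷ D)))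
      where perm = cycleNext-permutation S

    rotate-unrotate : rotate (unrotate (c ∷ D)) ≡ c ∷ D
    rotate-unrotate = trans (sym (map-∘ (c ∷ D)))
      (trans (map-cong (cycleNext-cyclePrev (⊆-peakValues-map perm) (peakValues-map-⊆ perm)) (c ∷ D)) (map-id (c ∷ D)))
      where perm = cyclePrev-permutation S

    module _ (peak-max : ∀ {z} → z ∈ D → Big z → z < c) where

      private
        ≤peak : ∀ {s} → s ∈ S → s ≤ c
        ≤peak (here refl) = ≤-refl
        ≤peak (there s∈) = let (s∈D , bs) = ∈-filter⁻ big? {xs = D} s∈ in <⇒≤ (peak-max s∈D bs)

        increases : ∀ {a} → a ∈ D → a ∈ S → a < cycleNext S a
        increases a∈ a∈S with cycleNext-spec a∈S
        ... | step _ _ a<w _  = a<w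
        ... | wrap _ _ top _  = contradiction (top (here refl)) (<⇒≱ (peak-max a∈ (peakValues-big a∈S)))

      rotate-≅ : D ≅ map (cycleNext S) D
      rotate-≅ = ≅-map-peakValues (cycleNext-permutation S) λ a∈ b∈ p q →
        CyclicSucc-<ᵇ (cycleNext-spec p) (cycleNext-spec q) (increases a∈ p) (increases b∈ q)

      rotate-head-least : ∀ {s} → s ∈ S → cycleNext S c ≤ s
      rotate-head-least with cycleNext-spec {S} (here refl)
      ... | step _ w∈ c<w _ = contradiction (≤peak w∈) (<⇒≱ c<w)
      ... | wrap _ _ _ bot  = bot

    module _ (peak-min : ∀ {z} → z ∈ D → Big z → c < z) where

      private
        peak≤ : ∀ {s} → s ∈ S → c ≤ s
        peak≤ (here refl) = ≤-refl
        peak≤ (there s∈) = let (s∈D , bs) = ∈-filter⁻ big? {xs = D} s∈ in <⇒≤ (peak-min s∈D bs)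

        decreases : ∀ {a} → a ∈ D → a ∈ S → cyclePrev S a < a
        decreases a∈ a∈S with cyclePrev-spec a∈S
        ... | step _ _ p<a _  = p<a
        ... | wrap _ _ _ bot  = contradiction (bot (here refl)) (<⇒≱ (peak-min a∈ (peakValues-big a∈S)))

      unrotate-≅ : D ≅ map (cyclePrev S) D
      unrotate-≅ = ≅-map-peakValues (cyclePrev-permutation S) λ a∈ b∈ p q →
        sym (CyclicSucc-<ᵇ (cyclePrev-spec p) (cyclePrev-spec q) (decreases a∈ p) (decreases b∈ q))

      unrotate-head-greatest : ∀ {s} → s ∈ S → s ≤ cyclePrev S c
      unrotate-head-greatest with cyclePrev-spec {S} (here refl)
      ... | step p∈ _ p<c _ = contradiction (peak≤ p∈) (<⇒≱ p<c)
      ... | wrap _ _ top _  = top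

-- The unimodal pattern

module Unimodal
  (i₀ m : ℕ) (1≤i₀ : 1 ≤ i₀) (1≤m : 1 ≤ m) (uA uB : List ℕ)
  (uA-length : length uA ≡ i₀) (uB-length : length uB ≡ m)
  (uA<k : All (_< suc (i₀ + m)) uA) (uB<k : All (_< suc (i₀ + m)) uB)
  (ascending : ∀ j → 1 ≤ j → j ≤ i₀ →
               at (uA ++ suc (i₀ + m) ∷ uB) j < at (uA ++ suc (i₀ + m) ∷ uB) (suc j))
  (descending : ∀ j → i₀ < j → j < suc (i₀ + m) →
                at (uA ++ suc (i₀ + m) ∷ uB) (suc j) < at (uA ++ suc (i₀ + m) ∷ uB) j)
  where

  k : ℕ
  k = suc (i₀ + m)

  u u′ : List ℕ
  u  = uA ++ k ∷ uB
  u′ = uA ++ suc k ∷ uB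

  patσ patτ : Vincular
  patσ = dashLast k (u ++ suc k ∷ [])
  patτ = dashLast k (u′ ++ k ∷ [])

  framed-length : ∀ p → length (uA ++ p ∷ uB) ≡ k
  framed-length p = trans (length-++ uA) (trans (cong₂ _+_ uA-length (cong suc uB-length)) (+-suc i₀ m))

  u<k : All (_< k) (uA ++ uB)
  u<k = ++⁺ uA<k uB<k

  u≅u′ : u ≅ u′
  u≅u′ = ≅-replace-max uA u<k (All.map (λ b<k → <-trans b<k (n<1+n k)) u<k)

  -- A window is an occurrence of u, the part of both patterns before the dash, at the start of a list.
  window : List ℕ → Bool
  window L = sameOrder (take k L) u

  Window : List ℕ → Set
  Window L = take k L ≅ u

  T-window : ∀ L → T (window L) ⇔ Window L
  T-window L = T-sameOrder (take k L) u

  window-true : ∀ {L} → Window L → window L ≡ true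
  window-true {L} w = Equivalence.to T-≡ (Equivalence.from (T-window L) w)

  window-true⁻ : ∀ {L} → window L ≡ true → Window L
  window-true⁻ {L} e = Equivalence.to (T-window L) (subst T (sym e) _)

  window-false : ∀ {L} → window L ≡ false → ¬ Window L
  window-false {L} e w = subst T e (Equivalence.from (T-window L) w)

  window-≅ : ∀ {L L′} → L ≅ L′ → window L ≡ window L′
  window-≅ p = sameOrder-≅ˡ u (≅-take k p)

  window-ascent : ∀ {L} j → Window L → 1 ≤ j → j < k → (at L j <ᵇ at L (suc j)) ≡ (at u j <ᵇ at u (suc j))
  window-ascent {L} j w 1≤j j<k =
    trans (sym (cong₂ _<ᵇ_ (at-take k L j (<⇒≤ j<k)) (at-take k L (suc j) j<k)))
          (≅-ascent j w 1≤j (subst (j <_) (sym (trans (≅-length w) (framed-length k))) j<k))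

  i₀<i₀+m : i₀ < i₀ + m
  i₀<i₀+m = subst (_< i₀ + m) (+-identityʳ i₀) (+-monoʳ-< i₀ 1≤m)

  -- Two windows cannot start at distance d with 1 ≤ d < k - 1: some position would be both
  -- an ascent of the second window and a descent of the first.
  no-overlap : ∀ L d → Window L → Window (drop d L) → 1 ≤ d → d < i₀ + m → ⊥
  no-overlap L d w w′ 1≤d d<i₀+m = by-cases (i₀ ≤? d)
    where
    descent : ∀ j → i₀ < j → j < k → (at L j <ᵇ at L (suc j)) ≡ false
    descent j i₀<j j<k = trans (window-ascent j w (≤-trans (s≤s z≤n) i₀<j) j<k) (<ᵇ-false (<⇒≤ (descending j i₀<j j<k)))

    ascent : ∀ e → suc e ≤ i₀ → (at L (suc (d + e)) <ᵇ at L (suc (suc (d + e)))) ≡ true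
    ascent e e<i₀ = begin
      at L (suc (d + e)) <ᵇ at L (suc (suc (d + e)))
        ≡⟨ cong₂ _<ᵇ_ (sym (at-drop d L e)) (trans (cong (λ j → at L (suc j)) (sym (+-suc d e))) (sym (at-drop d L (suc e)))) ⟩
      at (drop d L) (suc e) <ᵇ at (drop d L) (suc (suc e))
        ≡⟨ window-ascent (suc e) w′ (s≤s z≤n) (≤-<-trans e<i₀ (s≤s (m≤m+n i₀ m))) ⟩
      at u (suc e) <ᵇ at u (suc (suc e))
        ≡⟨ <ᵇ-true (ascending (suc e) (s≤s z≤n) e<i₀) ⟩
      true ∎
      where open ≡-Reasoning

    clash : ∀ e → i₀ < suc (d + e) → suc (d + e) < k → suc e ≤ i₀ → ⊥
    clash e p q r = contradiction (trans (sym (descent (suc (d + e)) p q)) (ascent e r)) λ ()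

    by-cases : Dec (i₀ ≤ d) → ⊥
    by-cases (yes i₀≤d) = clash 0 (s≤s (subst (i₀ ≤_) (sym (+-identityʳ d)) i₀≤d))
                                  (s≤s (subst (_< i₀ + m) (sym (+-identityʳ d)) d<i₀+m)) 1≤i₀
    by-cases (no i₀≰d)  = clash (i₀ ∸ d) (s≤s (≤-reflexive (sym d+e≡i₀))) (s≤s (subst (_< i₀ + m) (sym d+e≡i₀) i₀<i₀+m))
                                  (∸-monoʳ-< 1≤d (<⇒≤ (≰⇒> i₀≰d)))
      where
      d+e≡i₀ : d + (i₀ ∸ d) ≡ i₀
      d+e≡i₀ = m+[n∸m]≡n (<⇒≤ (≰⇒> i₀≰d))

  after-peak-length : ∀ {A : List ℕ} {c B} → length A ≡ i₀ → length (A ++ c ∷ B) ≡ k → length B ≡ m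
  after-peak-length {A} {c} {B} hA len = +-cancelˡ-≡ i₀ (length B) m (suc-injective (begin
    suc (i₀ + length B)       ≡⟨ sym (+-suc i₀ _) ⟩
    i₀ + suc (length B)       ≡⟨ cong (_+ _) (sym hA) ⟩
    length A + length (c ∷ B) ≡⟨ sym (length-++ A) ⟩
    length (A ++ c ∷ B)       ≡⟨ len ⟩
    suc (i₀ + m)              ∎))
    where open ≡-Reasoning

  head-condition : ∀ {t p z c A B} → length A ≡ i₀ → length B ≡ m → All (_< t) (uA ++ uB) →
    Pointwise (λ a b → (a <ᵇ z) ≡ (b <ᵇ t)) (A ++ c ∷ B) (uA ++ p ∷ uB) ⇔ (All (_< z) (A ++ B) × (c <ᵇ z) ≡ (p <ᵇ t))
  head-condition {t} {p} {z} {c} {A} {B} hA hB u<t = mk⇔ to from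
    where
    A≈ = trans hA (sym uA-length)
    B≈ = trans hB (sym uB-length)
    to : Pointwise (λ a b → (a <ᵇ z) ≡ (b <ᵇ t)) (A ++ c ∷ B) (uA ++ p ∷ uB) → All (_< z) (A ++ B) × (c <ᵇ z) ≡ (p <ᵇ t)
    to pw with Pointwise-++⁻ A {zs = p ∷ uB} A≈ pw
    ... | pA , (r ∷ pB) = ++⁺ (Equivalence.to (Pointwise-below⇔ (++⁻ˡ uA u<t) A≈) pA)
                              (Equivalence.to (Pointwise-below⇔ (++⁻ʳ uA u<t) B≈) pB) , r
    from : All (_< z) (A ++ B) × (c <ᵇ z) ≡ (p <ᵇ t) → Pointwise (λ a b → (a <ᵇ z) ≡ (b <ᵇ t)) (A ++ c ∷ B) (uA ++ p ∷ uB)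
    from (AB<z , r) = Pointwise.++⁺ (Equivalence.from (Pointwise-below⇔ (++⁻ˡ uA u<t) A≈) (++⁻ˡ A AB<z))
                        (r ∷ Equivalence.from (Pointwise-below⇔ (++⁻ʳ uA u<t) B≈) (++⁻ʳ A AB<z))

  at-head : ∀ {L A c B} p t → length A ≡ i₀ → take k L ≡ A ++ c ∷ B → All (_< t) (uA ++ uB) →
    T (containsAtHead (dashLast k ((uA ++ p ∷ uB) ++ t ∷ [])) L) ⇔
    (take k L ≅ uA ++ p ∷ uB × Any (λ z → All (_< z) (A ++ B) × (c <ᵇ z) ≡ (p <ᵇ t)) (drop k L))
  at-head {L} {A} {c} {B} p t hA tk u<t = mk⇔ to from
    where
    w = uA ++ p ∷ uB
    e = T-containsAtHead-dashLast (i₀ + m) w t L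
    cond : take k L ≅ w → ∀ {z} →
      Pointwise (λ a b → (a <ᵇ z) ≡ (b <ᵇ t)) (take k L) w ⇔ (All (_< z) (A ++ B) × (c <ᵇ z) ≡ (p <ᵇ t))
    cond win rewrite tk = head-condition hA (after-peak-length {A} {c} {B} hA (trans (≅-length win) (framed-length p))) u<t
    to = λ h → let (win , hit) = Equivalence.to e h in win , Any.map (Equivalence.to (cond win)) hit
    from = λ { (win , hit) → Equivalence.from e (win , Any.map (Equivalence.from (cond win)) hit) }

  σ-at-head : ∀ {L A c B} → length A ≡ i₀ → take k L ≡ A ++ c ∷ B → T (containsAtHead patσ L) ⇔
              (Window L × Any (λ z → All (_< z) (A ++ B) × c < z) (drop k L))
  σ-at-head hA tk = mk⇔
    (λ h → let (win , hit) = Equivalence.to e h in win , Any.map (λ (N<z , r) → N<z , <ᵇ-true⁻ (trans r k<ᵇ1+k)) hit)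
    (λ { (win , hit) → Equivalence.from e (win , Any.map (λ (N<z , c<z) → N<z , trans (<ᵇ-true c<z) (sym k<ᵇ1+k)) hit) })
    where
    e = at-head k (suc k) hA tk (All.map (λ b<k → <-trans b<k (n<1+n k)) u<k)
    k<ᵇ1+k = <ᵇ-true (n<1+n k)

  τ-at-head : ∀ {L A c B} → length A ≡ i₀ → take k L ≡ A ++ c ∷ B → T (containsAtHead patτ L) ⇔
              (Window L × Any (λ z → All (_< z) (A ++ B) × z ≤ c) (drop k L))
  τ-at-head hA tk = mk⇔
    (λ h → let (win , hit) = Equivalence.to e h in
           ≅-trans win (≅-sym u≅u′) , Any.map (λ (N<z , r) → N<z , <ᵇ-false⁻ (trans r 1+k≮ᵇk)) hit)
    (λ { (win , hit) → Equivalence.from e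
           (≅-trans win u≅u′ , Any.map (λ (N<z , z≤c) → N<z , trans (<ᵇ-false z≤c) (sym 1+k≮ᵇk)) hit) })
    where
    e = at-head (suc k) k hA tk u<k
    1+k≮ᵇk = <ᵇ-false (n≤1+n k)

  window-peak : ∀ {A c D} → length A ≡ i₀ → Window (A ++ c ∷ D) → Unique (A ++ c ∷ D) → All (_< c) (A ++ take m D)
  window-peak {A} {c} {D} hA w uq with ≅-peak A (trans hA (sym uA-length)) u<k (subst (_≅ u) (take-window i₀ m A c D hA) w)
  ... | A<c , T≤c = ++⁺ A<c (All.tabulate λ t∈ → ≤∧≢⇒< (All.lookup T≤c t∈) λ { refl → c∉T t∈ })
    where
    c∉T : c ∉ take m D
    c∉T c∈ = Unique-head (Unique-++ʳ A uq) (subst (c ∈_) (take++drop≡id m D) (∈-++⁺ˡ c∈))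

  offPeak : List ℕ → List ℕ
  offPeak L = take i₀ L ++ take m (drop (suc i₀) L)

  rotateWindow unrotateWindow : List ℕ → List ℕ
  rotateWindow L = take i₀ L ++ Rotation.rotate (offPeak L) (drop i₀ L)
  unrotateWindow L = take i₀ L ++ Rotation.unrotate (offPeak L) (drop i₀ L)

  module _ {A : List ℕ} {c : ℕ} {D : List ℕ} (hA : length A ≡ i₀) where

    rotateWindow-++ : rotateWindow (A ++ c ∷ D) ≡ A ++ Rotation.rotate (A ++ take m D) (c ∷ D)
    rotateWindow-++ rewrite take-++ i₀ A (c ∷ D) hA | drop-++ i₀ A (c ∷ D) hA | drop-suc-++ i₀ A c D hA = refl

    unrotateWindow-++ : unrotateWindow (A ++ c ∷ D) ≡ A ++ Rotation.unrotate (A ++ take m D) (c ∷ D)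
    unrotateWindow-++ rewrite take-++ i₀ A (c ∷ D) hA | drop-++ i₀ A (c ∷ D) hA | drop-suc-++ i₀ A c D hA = refl

  module Permuted {A : List ℕ} {c : ℕ} {D : List ℕ} (hA : length A ≡ i₀) (w : Window (A ++ c ∷ D)) (uq : Unique (A ++ c ∷ D))
                  {f} (perm : PermutationOn (Rotation.peakValues (A ++ take m D) (c ∷ D)) f) where
    open Rotation (A ++ take m D)
    open PermutationOn perm

    big-c : Big c
    big-c = window-peak hA w uq

    open AtPeak {D = D} big-c public

    rest-small : All (¬_ ∘ Big) (A ++ take m D)
    rest-small = All.tabulate λ z∈ bz → <-irrefl refl (All.lookup bz z∈)

    map-whole : map f (A ++ c ∷ D) ≡ A ++ f c ∷ map f D
    map-whole = trans (map-++ f A (c ∷ D)) (cong (_++ _) (map-fixes-small perm (++⁻ˡ A rest-small)))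

    take-rest : take m (map f D) ≡ take m D
    take-rest = trans (take-map m D) (map-fixes-small perm (++⁻ʳ A rest-small))

    window′ : Window (A ++ f c ∷ map f D)
    window′ = subst (_≅ u) (sym (trans (take-window i₀ m A (f c) (map f D) hA) (cong (λ T → A ++ f c ∷ T) take-rest)))
      (≅-trans (≅-replace-max A (peakValues-big (closed (here refl))) big-c)
               (subst (_≅ u) (take-window i₀ m A c D hA) w))

    unique′ : Unique (A ++ f c ∷ map f D)
    unique′ = subst Unique map-whole (map-unique uq)

    private
      peaks⊆ : peakValues (c ∷ D) ⊆ A ++ c ∷ D
      peaks⊆ = ∈-++⁺ʳ A ∘ peakValues-⊆ (c ∷ D)

    ⊆-before : A ++ f c ∷ map f D ⊆ A ++ c ∷ D
    ⊆-before = map-⊆ peaks⊆ ∘ subst (_ ∈_) (sym map-whole)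

    before-⊆ : A ++ c ∷ D ⊆ A ++ f c ∷ map f D
    before-⊆ = subst (_ ∈_) map-whole ∘ ⊆-map peaks⊆

    length′ : length (A ++ f c ∷ map f D) ≡ length (A ++ c ∷ D)
    length′ = trans (cong length (sym map-whole)) (length-map f (A ++ c ∷ D))

  module Rotated {A : List ℕ} {c : ℕ} {D : List ℕ} (hA : length A ≡ i₀) (w : Window (A ++ c ∷ D)) (uq : Unique (A ++ c ∷ D)) where
    open Rotation (A ++ take m D)

    S : List ℕ
    S = peakValues (c ∷ D)

    open Permuted hA w uq (cycleNext-permutation S) public

    unrotateWindow-rotateWindow : unrotateWindow (rotateWindow (A ++ c ∷ D)) ≡ A ++ c ∷ D
    unrotateWindow-rotateWindow = begin
      unrotateWindow (rotateWindow (A ++ c ∷ D))                                 ≡⟨ cong unrotateWindow (rotateWindow-++ hA) ⟩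
      unrotateWindow (A ++ rotate (c ∷ D))                               ≡⟨ unrotateWindow-++ hA ⟩
      A ++ Rotation.unrotate (A ++ take m (map (cycleNext S) D)) (rotate (c ∷ D))
                                                               ≡⟨ cong (λ T → A ++ Rotation.unrotate (A ++ T) (rotate (c ∷ D))) take-rest ⟩
      A ++ unrotate (rotate (c ∷ D))                           ≡⟨ cong (A ++_) unrotate-rotate ⟩
      A ++ c ∷ D                                               ∎
      where open ≡-Reasoning

    module _ (peak-max : ∀ {z} → z ∈ D → Big z → z < c) where

      tail-≅ : D ≅ map (cycleNext S) D
      tail-≅ = rotate-≅ peak-max

      new-peak-below : ∀ {z} → z ∈ map (cycleNext S) D → Big z → cycleNext S c < z
      new-peak-below {z} z∈ bz = ≤∧≢⇒<
        (rotate-head-least peak-max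
          (peakValues-map-⊆ (cycleNext-permutation S) (there (∈-filter⁺ big? z∈ bz))))
        λ { refl → Unique-head (Unique-++ʳ A unique′) z∈ }

  module Unrotated {A : List ℕ} {c : ℕ} {D : List ℕ} (hA : length A ≡ i₀) (w : Window (A ++ c ∷ D)) (uq : Unique (A ++ c ∷ D)) where
    open Rotation (A ++ take m D)

    S : List ℕ
    S = peakValues (c ∷ D)

    open Permuted hA w uq (cyclePrev-permutation S) public

    rotateWindow-unrotateWindow : rotateWindow (unrotateWindow (A ++ c ∷ D)) ≡ A ++ c ∷ D
    rotateWindow-unrotateWindow = begin
      rotateWindow (unrotateWindow (A ++ c ∷ D))                                 ≡⟨ cong rotateWindow (unrotateWindow-++ hA) ⟩
      rotateWindow (A ++ unrotate (c ∷ D))                             ≡⟨ rotateWindow-++ hA ⟩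
      A ++ Rotation.rotate (A ++ take m (map (cyclePrev S) D)) (unrotate (c ∷ D))
                                                               ≡⟨ cong (λ T → A ++ Rotation.rotate (A ++ T) (unrotate (c ∷ D))) take-rest ⟩
      A ++ rotate (unrotate (c ∷ D))                           ≡⟨ cong (A ++_) rotate-unrotate ⟩
      A ++ c ∷ D                                               ∎
      where open ≡-Reasoning

    module _ (peak-min : ∀ {z} → z ∈ D → Big z → c < z) where

      tail-≅ : D ≅ map (cyclePrev S) D
      tail-≅ = unrotate-≅ peak-min

      new-peak-above : ∀ {z} → z ∈ map (cyclePrev S) D → Big z → z < cyclePrev S c
      new-peak-above {z} z∈ bz = ≤∧≢⇒<
        (unrotate-head-greatest peak-min
          (peakValues-map-⊆ (cyclePrev-permutation S) (there (∈-filter⁺ big? z∈ bz))))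
        λ { refl → Unique-head (Unique-++ʳ A unique′) z∈ }

  big∈rest : ∀ {A D z} → z ∈ D → All (_< z) (A ++ take m D) → z ∈ drop m D
  big∈rest {A} {D} {z} z∈ bz with ∈-++⁻ (take m D) (subst (z ∈_) (sym (take++drop≡id m D)) z∈)
  ... | inj₁ z∈T = contradiction (All.lookup bz (∈-++⁺ʳ A z∈T)) (<-irrefl refl)
  ... | inj₂ z∈R = z∈R

  windowStarts : List ℕ → List Bool
  windowStarts []       = []
  windowStarts (x ∷ xs) = window (x ∷ xs) ∷ windowStarts xs

  windowStarts-≅ : ∀ {L L′} → L ≅ L′ → windowStarts L ≡ windowStarts L′
  windowStarts-≅ []          = refl
  windowStarts-≅ p@(_ ∷ q)   = cong₂ _∷_ (window-≅ p) (windowStarts-≅ q)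

  data AgreeToWindow : List ℕ → List ℕ → Set where
    []   : AgreeToWindow [] []
    stop : ∀ {x xs ys} → Window (x ∷ xs) → AgreeToWindow (x ∷ xs) (x ∷ ys)
    _∷_  : ∀ x {xs ys} → AgreeToWindow xs ys → AgreeToWindow (x ∷ xs) (x ∷ ys)

  record Similar (xs ys : List ℕ) : Set where
    field
      starts  : windowStarts xs ≡ windowStarts ys
      agree   : AgreeToWindow xs ys
      ⊆-right : xs ⊆ ys
      ⊆-left  : ys ⊆ xs
      length≡ : length xs ≡ length ys

  windowWithin : ℕ → List ℕ → Bool
  windowWithin zero    _        = false
  windowWithin (suc n) []       = false
  windowWithin (suc n) (x ∷ xs) = window (x ∷ xs) ∨ windowWithin n xs

  windowWithin-starts : ∀ n {xs ys} → windowStarts xs ≡ windowStarts ys → windowWithin n xs ≡ windowWithin n ys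
  windowWithin-starts zero    {_}      {_}      _ = refl
  windowWithin-starts (suc n) {[]}     {[]}     _ = refl
  windowWithin-starts (suc n) {x ∷ xs} {y ∷ ys} e =
    cong₂ _∨_ (∷-injectiveˡ e) (windowWithin-starts n (∷-injectiveʳ e))

  windowWithin-sound : ∀ n xs → T (windowWithin n xs) → ∃ λ j → j < n × Window (drop j xs)
  windowWithin-sound (suc n) (x ∷ xs) t with Equivalence.to T-∨ t
  ... | inj₁ w = 0 , s≤s z≤n , Equivalence.to (T-window (x ∷ xs)) w
  ... | inj₂ t′ = let (j , j<n , w) = windowWithin-sound n xs t′ in suc j , s≤s j<n , w

  agree-take : ∀ n {xs ys} → AgreeToWindow xs ys → ¬ T (windowWithin n xs) → take (suc n) xs ≡ take (suc n) ys
  agree-take n       []        _ = refl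
  agree-take zero    (stop w)  _ = refl
  agree-take (suc n) (stop w)  ¬t = contradiction (Equivalence.from T-∨ (inj₁ (Equivalence.from (T-window _) w))) ¬t
  agree-take zero    (x ∷ ag)  _ = refl
  agree-take (suc n) (x ∷ ag)  ¬t = cong (x ∷_) (agree-take n ag (¬t ∘ Equivalence.from T-∨ ∘ inj₂))

  private
    n₀ : ℕ
    n₀ = pred i₀ + m

    1+n₀ : suc n₀ ≡ i₀ + m
    1+n₀ = cong (_+ m) (suc-pred i₀ {{>-nonZero 1≤i₀}})

    no-window-after-early : ∀ x xs → T (windowWithin n₀ xs) → ¬ Window (x ∷ xs)
    no-window-after-early x xs t w =
      let (j , j<n₀ , w′) = windowWithin-sound n₀ xs t
      in no-overlap (x ∷ xs) (suc j) w w′ (s≤s z≤n) (subst (suc j <_) 1+n₀ (s≤s j<n₀))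

  -- Since windows do not overlap closely, whether x ∷ xs begins with a window depends only on
  -- the prefix of xs before its first window.
  module _ {xs ys} (sim : Similar xs ys) (x : ℕ) where
    open Similar sim

    window-head-take : Window (x ∷ xs) → take k (x ∷ xs) ≡ take k (x ∷ ys)
    window-head-take w with windowWithin n₀ xs in e
    ... | true  = contradiction w (no-window-after-early x xs (subst T (sym e) _))
    ... | false = cong (x ∷_) (subst (λ n → take n xs ≡ take n ys) 1+n₀ (agree-take n₀ agree (λ t → subst T e t)))

    window-head : window (x ∷ xs) ≡ window (x ∷ ys)
    window-head with windowWithin n₀ xs in e
    ... | true  = T-injective (λ t → contradiction (Equivalence.to (T-window _) t) (no-window-after-early x xs (subst T (sym e) _)))
                      (λ t → contradiction (Equivalence.to (T-window _) t)
                               (no-window-after-early x ys (subst T (trans (sym e) (windowWithin-starts n₀ starts)) _)))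
    ... | false = cong (λ L → sameOrder L u)
                    (cong (x ∷_) (subst (λ n → take n xs ≡ take n ys) 1+n₀ (agree-take n₀ agree (λ t → subst T e t))))

  Similar-∷ : ∀ {xs ys} → Similar xs ys → ∀ x → Similar (x ∷ xs) (x ∷ ys)
  Similar-∷ sim x = record
    { starts  = cong₂ _∷_ (window-head sim x) starts
    ; agree   = x ∷ agree
    ; ⊆-right = λ { (here e) → here e ; (there z∈) → there (⊆-right z∈) }
    ; ⊆-left  = λ { (here e) → here e ; (there z∈) → there (⊆-left z∈) }
    ; length≡ = cong suc length≡
    }
    where open Similar sim

  starts-rotated : ∀ {A c D c′ D′} → length A ≡ i₀ → Window (A ++ c ∷ D) → Window (A ++ c′ ∷ D′) → D ≅ D′ →
    windowStarts (A ++ c ∷ D) ≡ windowStarts (A ++ c′ ∷ D′)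
  starts-rotated {A} {c} {D} {c′} {D′} hA w w′ D≅D′ =
    starts-from (suc i₀) (A ++ c ∷ D) (A ++ c′ ∷ D′) same-length same-window
      (trans (cong windowStarts (drop-suc-++ i₀ A c D hA))
             (trans (windowStarts-≅ D≅D′) (cong windowStarts (sym (drop-suc-++ i₀ A c′ D′ hA)))))
    where
    starts-from : ∀ n L L′ → length L ≡ length L′ → (∀ j → j < n → window (drop j L) ≡ window (drop j L′)) →
                  windowStarts (drop n L) ≡ windowStarts (drop n L′) → windowStarts L ≡ windowStarts L′
    starts-from zero    L       L′       _ _  e = e
    starts-from (suc n) []      []       _ _  _ = refl
    starts-from (suc n) (x ∷ L) (y ∷ L′) l ws e =
      cong₂ _∷_ (ws 0 (s≤s z≤n)) (starts-from n L L′ (suc-injective l) (λ j j<n → ws (suc j) (s≤s j<n)) e)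
    same-length : length (A ++ c ∷ D) ≡ length (A ++ c′ ∷ D′)
    same-length = trans (length-++ A) (trans (cong (λ n → length A + suc n) (≅-length D≅D′)) (sym (length-++ A)))
    same-window : ∀ j → j < suc i₀ → window (drop j (A ++ c ∷ D)) ≡ window (drop j (A ++ c′ ∷ D′))
    same-window zero    _ = T-injective (λ _ → Equivalence.from (T-window _) w′) (λ _ → Equivalence.from (T-window _) w)
    same-window (suc j) (s≤s j<i₀) = T-injective
      (λ t → contradiction (Equivalence.to (T-window _) t) (λ w″ → no-overlap _ (suc j) w w″ (s≤s z≤n) gap))
      (λ t → contradiction (Equivalence.to (T-window _) t) (λ w″ → no-overlap _ (suc j) w′ w″ (s≤s z≤n) gap))
      where
      gap : suc j < i₀ + m
      gap = <-≤-trans (s≤s j<i₀) i₀<i₀+m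

  σ-head-window : ∀ L → T (containsAtHead patσ L) → Window L
  σ-head-window L = proj₁ ∘ Equivalence.to (T-containsAtHead-dashLast (i₀ + m) u (suc k) L)

  τ-head-window : ∀ L → T (containsAtHead patτ L) → Window L
  τ-head-window L h = ≅-trans (proj₁ (Equivalence.to (T-containsAtHead-dashLast (i₀ + m) u′ k L) h)) (≅-sym u≅u′)

  -- Occurrences begin with windows, and no window starts within the first i₀ positions after another.
  avoids-after-window : ∀ ρ → (∀ L → T (containsAtHead ρ L) → Window L) →
    ∀ {A c D} → length A ≡ i₀ → Window (A ++ c ∷ D) → Avoids ρ D → Avoids ρ (drop 1 (A ++ c ∷ D))
  avoids-after-window ρ head⇒window {A} {c} {D} hA w a =
    avoids-from ρ i₀ (drop 1 L) no-head (subst (Avoids ρ) (sym (trans (drop-drop 1 i₀ L) (drop-suc-++ i₀ A c D hA))) a)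
    where
    L = A ++ c ∷ D
    no-head : ∀ j → j < i₀ → ¬ T (containsAtHead ρ (drop j (drop 1 L)))
    no-head j j<i₀ h =
      no-overlap L (suc j) w (subst Window (drop-drop 1 j L) (head⇒window _ h)) (s≤s z≤n) (<-≤-trans (s≤s j<i₀) i₀<i₀+m)

  window-split : ∀ x ys → Window (x ∷ ys) → ∃ λ A′ → ∃ λ c → ∃ λ D → ys ≡ A′ ++ c ∷ D × length (x ∷ A′) ≡ i₀
  window-split x ys w with split i₀ (x ∷ ys) (<-≤-trans (s≤s (m≤m+n i₀ m)) (long (x ∷ ys) (trans (≅-length w) (framed-length k))))
    where
    long : ∀ L {n} → length (take n L) ≡ n → n ≤ length L
    long L       {zero}  _ = z≤n
    long (y ∷ L) {suc n} e = s≤s (long L (suc-injective e))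
  ... | []     , c , D , _    , hA = contradiction (subst (1 ≤_) (sym hA) 1≤i₀) λ ()
  ... | a ∷ A′ , c , D , refl , hA = A′ , c , D , refl , hA

  Φ-step Ψ-step : List ℕ → List ℕ
  Φ-step L = if window L then rotateWindow L else L
  Ψ-step   L = if window L then unrotateWindow L else L

  Φ : List ℕ → List ℕ
  Φ []       = []
  Φ (x ∷ xs) = Φ-step (x ∷ Φ xs)

  -- Ψ undoes Φ from left to right; its recursive call is not on a structural subterm, hence the fuel.
  Ψ-fuel : ℕ → List ℕ → List ℕ
  Ψ-fuel zero    L       = L
  Ψ-fuel (suc n) []      = []
  Ψ-fuel (suc n) (x ∷ L) = x ∷ Ψ-fuel n (drop 1 (Ψ-step (x ∷ L)))

  Ψ : List ℕ → List ℕ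
  Ψ L = Ψ-fuel (length L) L

  record Φ-StepFacts (x : ℕ) (xs ys : List ℕ) : Set where
    field
      unique  : Unique (Φ-step (x ∷ ys))
      avoids  : Avoids patτ (Φ-step (x ∷ ys))
      similar : Similar (x ∷ xs) (Φ-step (x ∷ ys))
      undo    : Ψ-step (Φ-step (x ∷ ys)) ≡ x ∷ ys

  Φ-step-window : ∀ {L} → window L ≡ true → Φ-step L ≡ rotateWindow L
  Φ-step-window {L} e = cong (λ b → if b then rotateWindow L else L) e

  Φ-step-no-window : ∀ {L} → window L ≡ false → Φ-step L ≡ L
  Φ-step-no-window {L} e = cong (λ b → if b then rotateWindow L else L) e

  Ψ-step-window : ∀ {L} → window L ≡ true → Ψ-step L ≡ unrotateWindow L
  Ψ-step-window {L} e = cong (λ b → if b then unrotateWindow L else L) e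

  Ψ-step-no-window : ∀ {L} → window L ≡ false → Ψ-step L ≡ L
  Ψ-step-no-window {L} e = cong (λ b → if b then unrotateWindow L else L) e

  Φ-step-facts-window : ∀ {x xs ys A′ c D} → ys ≡ A′ ++ c ∷ D → length (x ∷ A′) ≡ i₀ → window (x ∷ ys) ≡ true →
    Unique (x ∷ xs) → Avoids patσ (x ∷ xs) → Unique ys → Avoids patτ ys → Similar xs ys → Φ-StepFacts x xs ys
  Φ-step-facts-window {x} {xs} {_} {A′} {c} {D} refl hA e uX aX uY aY sim = record
    { unique  = subst Unique (sym Φ-step≡) unique′
    ; avoids  = subst (Avoids patτ) (sym Φ-step≡) (avoids-∷⁺ patτ no-τ-head
                  (avoids-after-window patτ τ-head-window hA window′ (avoids-≅ patτ (tail-≅ peak-max) avoids-D)))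
    ; similar = subst (Similar (x ∷ xs)) (sym Φ-step≡) similar′
    ; undo    = trans (cong Ψ-step Φ-step≡) (trans (Ψ-step-window (window-true window′))
                  (trans (cong unrotateWindow (sym rotateWindow≡)) unrotateWindow-rotateWindow))
    }
    where
    open Similar sim
    A = x ∷ A′
    L = A ++ c ∷ D
    w : Window L
    w = window-true⁻ e
    uq : Unique L
    uq = Unique-∷-⊆ uX ⊆-left uY
    open Rotation (A ++ take m D) using (Big)
    open Rotated hA w uq
    L′ = A ++ cycleNext S c ∷ map (cycleNext S) D
    rotateWindow≡ : rotateWindow L ≡ L′
    rotateWindow≡ = rotateWindow-++ hA
    Φ-step≡ : Φ-step L ≡ L′
    Φ-step≡ = trans (Φ-step-window e) rotateWindow≡
    wX : Window (x ∷ xs)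
    wX = window-true⁻ (trans (window-head sim x) e)
    same-window : take k (x ∷ xs) ≡ A ++ c ∷ take m D
    same-window = trans (window-head-take sim x wX) (take-window i₀ m A c D hA)
    -- a big entry of D above c would complete an occurrence of σ in x ∷ xs
    peak-max : ∀ {z} → z ∈ D → Big z → z < c
    peak-max {z} z∈ bz with z <? c
    ... | yes z<c = z<c
    ... | no z≮c = contradiction (Equivalence.from (σ-at-head hA same-window) (wX , Any.map (λ { refl → bz , c<z }) later))
                                 (proj₁ (avoids-∷⁻ patσ aX))
      where
      c<z : c < z
      c<z = ≤∧≢⇒< (≮⇒≥ z≮c) λ { refl → Unique-head (Unique-++ʳ A uq) z∈ }
      later : z ∈ drop k (x ∷ xs)
      later = drop-⊆ k (window-head-take sim x wX) (Similar.⊆-left (Similar-∷ sim x)) uq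
                (subst (z ∈_) (sym (drop-window i₀ m A c D hA)) (big∈rest {A} z∈ bz))
    no-τ-head : ¬ T (containsAtHead patτ L′)
    no-τ-head h with find (proj₂ (Equivalence.to (τ-at-head hA (take-window i₀ m A (cycleNext S c) (map (cycleNext S) D) hA)) h))
    ... | z , z∈ , N<z , z≤c′ = <⇒≱ (new-peak-below peak-max z∈D (subst (λ T → All (_< z) (A ++ T)) take-rest N<z)) z≤c′
      where
      z∈D : z ∈ map (cycleNext S) D
      z∈D = ∈-drop m (subst (z ∈_) (drop-window i₀ m A _ _ hA) z∈)
    avoids-D : Avoids patτ D
    avoids-D = subst (Avoids patτ) (drop-suc-++ (length A′) A′ c D refl) (avoids-drop patτ (suc (length A′)) {A′ ++ c ∷ D} aY)
    similar′ : Similar (x ∷ xs) L′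
    similar′ = record
      { starts  = trans (Similar.starts (Similar-∷ sim x)) (starts-rotated hA w window′ (tail-≅ peak-max))
      ; agree   = stop wX
      ; ⊆-right = before-⊆ ∘ Similar.⊆-right (Similar-∷ sim x)
      ; ⊆-left  = Similar.⊆-left (Similar-∷ sim x) ∘ ⊆-before
      ; length≡ = trans (cong suc length≡) (sym length′)
      }

  Φ-step-facts : ∀ {x xs ys} → Unique (x ∷ xs) → Avoids patσ (x ∷ xs) → Unique ys → Avoids patτ ys → Similar xs ys →
              Φ-StepFacts x xs ys
  Φ-step-facts {x} {xs} {ys} uX aX uY aY sim = by-cases (window (x ∷ ys)) refl
    where
    open Similar sim
    by-cases : ∀ b → window (x ∷ ys) ≡ b → Φ-StepFacts x xs ys
    by-cases true  e = let (A′ , c , D , ys≡ , hA) = window-split x ys (window-true⁻ e)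
                       in Φ-step-facts-window ys≡ hA e uX aX uY aY sim
    by-cases false e = record
      { unique  = subst Unique (sym same) (Unique-∷-⊆ uX ⊆-left uY)
      ; avoids  = subst (Avoids patτ) (sym same) (avoids-∷⁺ patτ (window-false e ∘ τ-head-window (x ∷ ys)) aY)
      ; similar = subst (Similar (x ∷ xs)) (sym same) (Similar-∷ sim x)
      ; undo    = trans (cong Ψ-step same) (Ψ-step-no-window e)
      }
      where
      same = Φ-step-no-window e

  record Ψ-StepFacts (x : ℕ) (ms ys : List ℕ) : Set where
    field
      unique  : Unique ys
      avoids  : Avoids patτ ys
      length≡ : length ys ≡ length ms
      redo    : Φ-step (x ∷ ys) ≡ x ∷ ms
      extend  : ∀ {P} → Unique P → Avoids patσ P → Similar ys P →
                Unique (x ∷ P) × Avoids patσ (x ∷ P) × Similar (x ∷ ms) (x ∷ P)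

  Ψ-step-facts-window : ∀ {x ms A′ c D} → ms ≡ A′ ++ c ∷ D → length (x ∷ A′) ≡ i₀ → window (x ∷ ms) ≡ true →
    Unique (x ∷ ms) → Avoids patτ (x ∷ ms) → Ψ-StepFacts x ms (drop 1 (Ψ-step (x ∷ ms)))
  Ψ-step-facts-window {x} {_} {A′} {c} {D} refl hA e uX aX = subst (λ R → Ψ-StepFacts x (A′ ++ c ∷ D) (drop 1 R)) (sym Ψ-step≡) (record
    { unique  = Unique-++ʳ (x ∷ []) unique′
    ; avoids  = avoids-after-window patτ τ-head-window hA window′ (avoids-≅ patτ (tail-≅ peak-min) avoids-D)
    ; length≡ = suc-injective length′
    ; redo    = trans (Φ-step-window (window-true window′)) (trans (cong rotateWindow (sym unrotateWindow≡)) rotateWindow-unrotateWindow)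
    ; extend  = extend
    })
    where
    A = x ∷ A′
    L = A ++ c ∷ D
    w : Window L
    w = window-true⁻ e
    open Rotation (A ++ take m D) using (Big)
    open Unrotated hA w uX
    L″ = A ++ cyclePrev S c ∷ map (cyclePrev S) D
    unrotateWindow≡ : unrotateWindow L ≡ L″
    unrotateWindow≡ = unrotateWindow-++ hA
    Ψ-step≡ : Ψ-step L ≡ L″
    Ψ-step≡ = trans (Ψ-step-window e) unrotateWindow≡
    -- a big entry of D below c would complete an occurrence of τ in L
    peak-min : ∀ {z} → z ∈ D → Big z → c < z
    peak-min {z} z∈ bz with c <? z
    ... | yes c<z = c<z
    ... | no c≮z = contradiction
      (Equivalence.from (τ-at-head hA (take-window i₀ m A c D hA)) (w , Any.map (λ { refl → bz , ≮⇒≥ c≮z }) later))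
                                 (proj₁ (avoids-∷⁻ patτ aX))
      where
      later : z ∈ drop k L
      later = subst (z ∈_) (sym (drop-window i₀ m A c D hA)) (big∈rest {A} z∈ bz)
    avoids-D : Avoids patτ D
    avoids-D = subst (Avoids patτ) (drop-suc-++ i₀ A c D hA) (avoids-drop patτ (suc i₀) {L} aX)
    extend : ∀ {P} → Unique P → Avoids patσ P → Similar (drop 1 L″) P →
             Unique (x ∷ P) × Avoids patσ (x ∷ P) × Similar L (x ∷ P)
    extend {P} uP aP sim = uXP , avoids-∷⁺ patσ no-σ-head aP , similar′
      where
      sim∷ = Similar-∷ sim x
      uXP : Unique (x ∷ P)
      uXP = Unique-∷-⊆ unique′ (Similar.⊆-left sim) uP
      no-σ-head : ¬ T (containsAtHead patσ (x ∷ P))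
      no-σ-head h with find (proj₂ (Equivalence.to (σ-at-head hA same-window) h))
        where
        same-window : take k (x ∷ P) ≡ A ++ cyclePrev S c ∷ take m (map (cyclePrev S) D)
        same-window = trans (sym (window-head-take sim x window′)) (take-window i₀ m A _ _ hA)
      ... | z , z∈ , N<z , c″<z = <⇒≱ (new-peak-above peak-min z∈D (subst (λ T → All (_< z) (A ++ T)) take-rest N<z)) (<⇒≤ c″<z)
        where
        z∈D : z ∈ map (cyclePrev S) D
        z∈D = ∈-drop m (subst (z ∈_) (drop-window i₀ m A _ _ hA)
                (drop-⊆ k (window-head-take sim x window′) (Similar.⊆-left sim∷) uXP z∈))
      similar′ : Similar L (x ∷ P)
      similar′ = record
        { starts  = trans (starts-rotated hA w window′ (tail-≅ peak-min)) (Similar.starts sim∷)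
        ; agree   = stop w
        ; ⊆-right = Similar.⊆-right sim∷ ∘ before-⊆
        ; ⊆-left  = ⊆-before ∘ Similar.⊆-left sim∷
        ; length≡ = trans (sym length′) (Similar.length≡ sim∷)
        }

  Ψ-step-facts : ∀ {x ms} → Unique (x ∷ ms) → Avoids patτ (x ∷ ms) → Ψ-StepFacts x ms (drop 1 (Ψ-step (x ∷ ms)))
  Ψ-step-facts {x} {ms} uX aX = by-cases (window (x ∷ ms)) refl
    where
    by-cases : ∀ b → window (x ∷ ms) ≡ b → Ψ-StepFacts x ms (drop 1 (Ψ-step (x ∷ ms)))
    by-cases true  e = let (A′ , c , D , ms≡ , hA) = window-split x ms (window-true⁻ e)
                       in Ψ-step-facts-window ms≡ hA e uX aX
    by-cases false e = subst (λ R → Ψ-StepFacts x ms (drop 1 R)) (sym (Ψ-step-no-window {x ∷ ms} e)) (record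
      { unique  = Unique-++ʳ (x ∷ []) uX
      ; avoids  = proj₂ (avoids-∷⁻ patτ aX)
      ; length≡ = refl
      ; redo    = Φ-step-no-window e
      ; extend  = λ {P} uP aP sim →
          Unique-∷-⊆ uX (Similar.⊆-left sim) uP ,
          avoids-∷⁺ patσ (window-false (trans (sym (window-head sim x)) e) ∘ σ-head-window (x ∷ P)) aP ,
          Similar-∷ sim x
      })

  Similar-[] : Similar [] []
  Similar-[] = record { starts = refl ; agree = [] ; ⊆-right = id ; ⊆-left = id ; length≡ = refl }

  Ψ-∷ : ∀ {x R ys} → Ψ-step (x ∷ R) ≡ x ∷ ys → length R ≡ length ys → Ψ (x ∷ R) ≡ x ∷ Ψ ys
  Ψ-∷ {x} {R} undo len = cong (x ∷_) (trans (cong (λ L → Ψ-fuel (length R) (drop 1 L)) undo) (cong (λ n → Ψ-fuel n _) len))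

  agree-head : ∀ {x xs R} → AgreeToWindow (x ∷ xs) R → ∃ λ R′ → R ≡ x ∷ R′
  agree-head (stop _) = _ , refl
  agree-head (_ ∷ _)  = _ , refl

  Φ-spec : ∀ xs → Unique xs → Avoids patσ xs →
           Unique (Φ xs) × Avoids patτ (Φ xs) × Similar xs (Φ xs) × Ψ (Φ xs) ≡ xs
  Φ-spec []       _          _  = [] , (λ ()) , Similar-[] , refl
  Φ-spec (x ∷ xs) uX@(_ ∷ u) aX with Φ-spec xs u (proj₂ (avoids-∷⁻ patσ aX))
  ... | uY , aY , sim , Ψ∘Φ = unique , avoids , similar , inverse
    where
    open Φ-StepFacts (Φ-step-facts uX aX uY aY sim)
    inverse : Ψ (Φ-step (x ∷ Φ xs)) ≡ x ∷ xs
    inverse with agree-head (Similar.agree similar)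
    ... | R′ , eq = trans (cong Ψ eq) (trans (Ψ-∷ (subst (λ L → Ψ-step L ≡ x ∷ Φ xs) eq undo) len) (cong (x ∷_) Ψ∘Φ))
      where
      len : length R′ ≡ length (Φ xs)
      len = trans (sym (suc-injective (trans (Similar.length≡ similar) (cong length eq)))) (Similar.length≡ sim)

  Ψ-spec : ∀ n ms → length ms ≡ n → Unique ms → Avoids patτ ms →
           Unique (Ψ-fuel n ms) × Avoids patσ (Ψ-fuel n ms) × Similar ms (Ψ-fuel n ms) × Φ (Ψ-fuel n ms) ≡ ms
  Ψ-spec zero    []       _   _  _  = [] , (λ ()) , Similar-[] , refl
  Ψ-spec (suc n) (x ∷ ms) len uX aX with Ψ-spec n _ (trans length≡ (suc-injective len)) unique avoids
    where open Ψ-StepFacts (Ψ-step-facts uX aX)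
  ... | uP , aP , sim , Φ∘Ψ = let (uXP , aXP , simXP) = extend uP aP sim in
                              uXP , aXP , simXP , trans (cong (λ P → Φ-step (x ∷ P)) Φ∘Ψ) redo
    where open Ψ-StepFacts (Ψ-step-facts uX aX)

  agree-at : ∀ {xs ys} → AgreeToWindow xs ys → at xs 1 ≡ at ys 1
  agree-at []       = refl
  agree-at (stop _) = refl
  agree-at (_ ∷ _)  = refl

  Φ-transfers : Transfers patσ patτ Φ Ψ
  Φ-transfers {π = π} p a with Φ-spec π (proj₁ (isPerm-unique p)) a
  ... | _ , aΦ , sim , inv = isPerm-resp (Similar.⊆-right sim) (Similar.length≡ sim) p , aΦ , sym (agree-at (Similar.agree sim)) , inv

  Ψ-transfers : Transfers patτ patσ Ψ Φ
  Ψ-transfers {π = π} p a with Ψ-spec (length π) π refl (proj₁ (isPerm-unique p)) a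
  ... | _ , aΨ , sim , inv = isPerm-resp (Similar.⊆-right sim) (Similar.length≡ sim) p , aΨ , sym (agree-at (Similar.agree sim)) , inv

Wilf : Vincular → Vincular → Set
Wilf ρ ρ′ = ((n : ℕ) → Av ρ n ↔ Av ρ′ n) × ((n a : ℕ) → 1 ≤ n → 1 ≤ a → a ≤ n → AvFirst ρ n a ↔ AvFirst ρ′ n a)

module Decomposition (i₀ m : ℕ) (σ : List ℕ) (σ-perm : T (isPerm (suc (suc (i₀ + m))) σ))
             (σ-last : at σ (suc (suc (i₀ + m))) ≡ suc (suc (i₀ + m)))
             (asc : ∀ j → 1 ≤ j → j < suc i₀ → at σ j < at σ (suc j))
             (des : ∀ j → suc i₀ ≤ j → j < suc (i₀ + m) → at σ (suc j) < at σ j) where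

  k : ℕ
  k = suc (i₀ + m)

  σ-length : length σ ≡ suc k
  σ-length = proj₁ (Equivalence.to (T-isPerm (suc k) σ) σ-perm)

  u : List ℕ
  u = take k σ

  σ≡u∷ : σ ≡ u ++ suc k ∷ []
  σ≡u∷ = trans (split-at k σ (≤-reflexive (sym σ-length)))
               (cong₂ (λ c D → u ++ c ∷ D) σ-last (drop-all (suc k) σ (≤-reflexive σ-length)))

  u-length : length u ≡ k
  u-length = trans (length-take k σ) (m≤n⇒m⊓n≡m (≤-trans (n≤1+n k) (≤-reflexive (sym σ-length))))

  private
    σ-unique : Unique (u ++ suc k ∷ [])
    σ-unique = subst Unique σ≡u∷ (proj₁ (isPerm-unique σ-perm))

    u-unique : Unique u
    u-unique = Uniqueₚ.take⁺ k (proj₁ (isPerm-unique σ-perm))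

    u-below : ∀ {z} → z ∈ u → z ≤ k
    u-below {z} z∈ = ≤-pred (≤∧≢⇒<
      (proj₂ (∈-oneTo⁻ (proj₂ (isPerm-unique σ-perm) (subst (z ∈_) (sym σ≡u∷) (∈-++⁺ˡ z∈)))))
      (λ { refl → Unique-disjoint u σ-unique z∈ (here refl) }))

    k∈u : k ∈ u
    k∈u with ∈-++⁻ u (subst (k ∈_) σ≡u∷
      (proj₂ (Equivalence.to (T-isPerm (suc k) σ) σ-perm) (∈-map⁺ suc (∈-upTo⁺ (≤-trans (n<1+n (i₀ + m)) (n≤1+n k))))))
    ... | inj₁ k∈ = k∈
    ... | inj₂ (here k≡1+k) = contradiction k≡1+k (<⇒≢ (n<1+n k))

    at-u : ∀ j → j ≤ k → at u j ≡ at σ j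
    at-u = at-take k σ

    climb : ∀ d j → j + d ≡ suc i₀ → 1 ≤ j → at σ j ≤ at σ (suc i₀)
    climb zero    j e _   = ≤-reflexive (cong (at σ) (trans (sym (+-identityʳ j)) e))
    climb (suc d) j e 1≤j = <⇒≤ (<-≤-trans (asc j 1≤j j<) (climb d (suc j) (trans (sym (+-suc j d)) e) (s≤s z≤n)))
      where
      j< : j < suc i₀
      j< = subst (j <_) e (subst (_≤ j + suc d) (+-identityʳ (suc j)) (subst (suc j + 0 ≤_) (sym (+-suc j d)) (s≤s (+-monoʳ-≤ j z≤n))))

    descend : ∀ d → suc i₀ + d ≤ k → at σ (suc i₀ + d) ≤ at σ (suc i₀)
    descend zero    _  = ≤-reflexive (cong (at σ) (+-identityʳ (suc i₀)))
    descend (suc d) le = <⇒≤ (<-≤-trans (subst (λ j → at σ j < at σ (suc i₀ + d)) (sym (+-suc (suc i₀) d))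
                                              (des (suc i₀ + d) (m≤m+n (suc i₀) d) (subst (_≤ k) (+-suc (suc i₀) d) le)))
                                       (descend d (≤-trans (+-monoʳ-≤ (suc i₀) (n≤1+n d)) le)))

    dominated : ∀ j → 1 ≤ j → j ≤ k → at σ j ≤ at σ (suc i₀)
    dominated j 1≤j j≤k with j ≤? suc i₀
    ... | yes j≤ = climb (suc i₀ ∸ j) j (m+[n∸m]≡n j≤) 1≤j
    ... | no j≰ = subst (λ j′ → at σ j′ ≤ at σ (suc i₀)) e (descend (j ∸ suc i₀) (subst (_≤ k) (sym e) j≤k))
      where
      e : suc i₀ + (j ∸ suc i₀) ≡ j
      e = m+[n∸m]≡n (<⇒≤ (≰⇒> j≰))

    peak : at σ (suc i₀) ≡ k
    peak with at-∈ u k∈u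
    ... | j , 1≤j , j≤ , e = ≤-antisym
      (subst (_≤ k) (at-u (suc i₀) i₀<k) (u-below (∈-at u (suc i₀) (s≤s z≤n) (subst (suc i₀ ≤_) (sym u-length) i₀<k))))
      (subst (_≤ at σ (suc i₀)) (trans (sym (at-u j j≤k)) e) (dominated j 1≤j j≤k))
      where
      i₀<k = s≤s (m≤m+n i₀ m)
      j≤k = subst (j ≤_) u-length j≤

  uA uB : List ℕ
  uA = take i₀ u
  uB = drop (suc i₀) u

  u≡ : u ≡ uA ++ k ∷ uB
  u≡ = trans (split-at i₀ u (subst (i₀ <_) (sym u-length) (s≤s (m≤m+n i₀ m))))
             (cong (λ c → uA ++ c ∷ uB) (trans (at-u (suc i₀) (s≤s (m≤m+n i₀ m))) peak))

  uA-length : length uA ≡ i₀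
  uA-length = trans (length-take i₀ u) (m≤n⇒m⊓n≡m (subst (i₀ ≤_) (sym u-length) (≤-trans (m≤m+n i₀ m) (n≤1+n _))))

  uB-length : length uB ≡ m
  uB-length = trans (length-drop (suc i₀) u) (trans (cong (_∸ suc i₀) u-length) (m+n∸m≡n (suc i₀) m))

  private
    u≡-unique : Unique (uA ++ k ∷ uB)
    u≡-unique = subst Unique u≡ u-unique

    below-peak : ∀ {z} → z ∈ uA ++ k ∷ uB → z ≢ k → z < k
    below-peak z∈ z≢k = ≤∧≢⇒< (u-below (subst (_ ∈_) (sym u≡) z∈)) z≢k

  uA<k : All (_< k) uA
  uA<k = All.tabulate λ z∈ → below-peak (∈-++⁺ˡ z∈) λ { refl → Unique-disjoint uA u≡-unique z∈ (here refl) }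

  uB<k : All (_< k) uB
  uB<k = All.tabulate λ z∈ → below-peak (∈-++⁺ʳ uA (there z∈)) λ { refl → Unique-head (Unique-++ʳ uA u≡-unique) z∈ }

  ascending : ∀ j → 1 ≤ j → j ≤ i₀ → at (uA ++ k ∷ uB) j < at (uA ++ k ∷ uB) (suc j)
  ascending j 1≤j j≤i₀ = subst (λ v → at v j < at v (suc j)) u≡
    (subst₂ _<_ (sym (at-u j (≤-trans j≤i₀ (≤-trans (m≤m+n i₀ m) (n≤1+n _)))))
                (sym (at-u (suc j) (s≤s (≤-trans j≤i₀ (m≤m+n i₀ m)))))
                (asc j 1≤j (s≤s j≤i₀)))

  descending : ∀ j → i₀ < j → j < k → at (uA ++ k ∷ uB) (suc j) < at (uA ++ k ∷ uB) j
  descending j i₀<j j<k = subst (λ v → at v (suc j) < at v j) u≡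
    (subst₂ _<_ (sym (at-u (suc j) j<k)) (sym (at-u j (<⇒≤ j<k))) (des j i₀<j j<k))

  σ≡ : σ ≡ (uA ++ k ∷ uB) ++ suc k ∷ []
  σ≡ = trans σ≡u∷ (cong (_++ suc k ∷ []) u≡)

  swap≡ : swapLetters k σ ≡ (uA ++ suc k ∷ uB) ++ k ∷ []
  swap≡ = begin
    swapLetters k σ                                          ≡⟨ cong (swapLetters k) σ≡ ⟩
    map sw ((uA ++ k ∷ uB) ++ suc k ∷ [])                    ≡⟨ map-++ sw (uA ++ k ∷ uB) _ ⟩
    map sw (uA ++ k ∷ uB) ++ sw (suc k) ∷ []                 ≡⟨ cong₂ _++_ (map-++ sw uA (k ∷ uB)) (cong (_∷ []) sw-1+k) ⟩
    (map sw uA ++ sw k ∷ map sw uB) ++ k ∷ []                ≡⟨ cong (_++ k ∷ []) (cong₂ _++_ (fixed uA<k) (cong₂ _∷_ sw-k (fixed uB<k))) ⟩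
    (uA ++ suc k ∷ uB) ++ k ∷ []                             ∎
    where
    open ≡-Reasoning
    sw : ℕ → ℕ
    sw x = if x ≡ᵇ k then suc k else (if x ≡ᵇ suc k then k else x)
    ≡ᵇ-true : ∀ n → (n ≡ᵇ n) ≡ true
    ≡ᵇ-true n = Equivalence.to T-≡ (≡⇒≡ᵇ n n refl)
    ≡ᵇ-false : ∀ {a b} → a ≢ b → (a ≡ᵇ b) ≡ false
    ≡ᵇ-false {a} {b} a≢b = Equivalence.to T-not-≡ (Equivalence.from T-not (a≢b ∘ ≡ᵇ⇒≡ a b))
    sw-k : sw k ≡ suc k
    sw-k rewrite ≡ᵇ-true k = refl
    sw-1+k : sw (suc k) ≡ k
    sw-1+k rewrite ≡ᵇ-false {suc k} {k} (<⇒≢ (n<1+n k) ∘ sym) | ≡ᵇ-true (suc k) = refl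
    sw-fix : ∀ {x} → x < k → sw x ≡ x
    sw-fix {x} x<k rewrite ≡ᵇ-false (<⇒≢ x<k) | ≡ᵇ-false {x} {suc k} (<⇒≢ (<-trans x<k (n<1+n k))) = refl
    fixed : ∀ {U} → All (_< k) U → map sw U ≡ U
    fixed = map-id-local ∘ All.map sw-fix

wilf-unimodal : ∀ i₀ m → 1 ≤ i₀ → 1 ≤ m → (σ : List ℕ) →
  T (isPerm (suc (suc (i₀ + m))) σ) → at σ (suc (suc (i₀ + m))) ≡ suc (suc (i₀ + m)) →
  (∀ j → 1 ≤ j → j < suc i₀ → at σ j < at σ (suc j)) →
  (∀ j → suc i₀ ≤ j → j < suc (i₀ + m) → at σ (suc j) < at σ j) →
  Wilf (dashLast (suc (i₀ + m)) σ) (dashLast (suc (i₀ + m)) (swapLetters (suc (i₀ + m)) σ))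
wilf-unimodal i₀ m 1≤i₀ 1≤m σ σ-perm σ-last asc des =
  subst₂ (λ s t → Wilf (dashLast k s) (dashLast k t)) (sym σ≡) (sym swap≡)
    (Av-↔ Φ Ψ Φ-transfers Ψ-transfers , λ n a _ _ _ → AvFirst-↔ Φ Ψ Φ-transfers Ψ-transfers n a)
  where
  open Decomposition i₀ m σ σ-perm σ-last asc des
  open Unimodal i₀ m 1≤i₀ 1≤m uA uB uA-length uB-length uA<k uB<k ascending descending using (Φ; Ψ; Φ-transfers; Ψ-transfers)

-- The hypothesis 3 ≤ k follows from 2 ≤ i < k.
theorem3p1 : (k i : ℕ) → 3 ≤ k → 2 ≤ i → i < k →
    (σ : List ℕ) → T (isPerm (suc k) σ) → at σ (suc k) ≡ suc k →
    (∀ j → 1 ≤ j → j < i → at σ j < at σ (suc j)) →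
    (∀ j → i ≤ j → j < k → at σ (suc j) < at σ j) →
    ((n : ℕ) → Av (dashLast k σ) n ↔ Av (dashLast k (swapLetters k σ)) n)
    × ((n a : ℕ) → 1 ≤ n → 1 ≤ a → a ≤ n →
       AvFirst (dashLast k σ) n a ↔ AvFirst (dashLast k (swapLetters k σ)) n a)
theorem3p1 k (suc zero)      _ (s≤s ()) _
theorem3p1 k (suc (suc i₁)) _ _ i<k with k ∸ suc (suc i₁) | m+[n∸m]≡n (<⇒≤ i<k) | m<n⇒0<n∸m i<k
... | m | refl | 1≤m = wilf-unimodal (suc i₁) m (s≤s z≤n) 1≤m
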